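{- Let $k\ge 2$ be an integer and $D$ a square-free positive integer, and suppose $(t(x),r(x),q(x))$ parameterizes a complete family of pairing-friendly elliptic curves with embedding degree $k$ and CM-discriminant $D$; in particular $r(x)\mid\Phi_k(t(x)-1)$, $q(x)+1-t(x)=h(x)r(x)$ for some non-zero $h(x)\in\mathbb{Q}[x]$, and $Dy(x)^2=4h(x)r(x)-(t(x)-2)^2$ for some $y(x)\in\mathbb{Q}[x]$. Let $K$ be a number field isomorphic to $\mathbb{Q}[x]/(r(x))$. Then $K$ contains the imaginary quadratic field $\mathbb{Q}(\sqrt{ -D})$, and there exists $e(x)\in\mathbb{Q}[x]$ with $-D\equiv e(x)^2 \pmod{r(x)}$.
   Context: $\Phi_k(x)$ is the $k$th cyclotomic polynomial. A polynomial $f(x)\in\mathbb{Q}[x]$ represents integers if there is $a\in\mathbb{Z}$ with $f(a)\in\mathbb{Z}$; a non-constant irreducible $f$ representing integers represents primes if it has positive leading coefficient and $\gcd\{f(a): a\in\mathbb{Z}, f(a)\in\mathbb{Z}\}=1$. A triple of non-zero polynomials $(t,r,q)\in\mathbb{Q}[x]^3$ parameterizes a complete family of pairing-friendly elliptic curves with embedding degree $k$ and CM-discriminant $D$ if: $r$ represents primes; $q$ is a power of a polynomial representing primes; $h(x)r(x)=q(x)+1-t(x)$ for some $h\in\mathbb{Q}[x]$; $r(x)\mid\Phi_k(t(x)-1)$; and $Dy(x)^2=4q(x)-t(x)^2$ for some $y\in\mathbb{Q}[x]$. In particular $r(x)$ is irreducible, so $\mathbb{Q}[x]/(r(x))$ is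 a field. -}

module Defs where

open import Data.Nat as ℕ using (ℕ; zero; suc; _≤_; _<_; _<?_)
open import Data.Nat.Divisibility as ℕD using ()
open import Data.Integer as ℤ using (ℤ; +_)
open import Data.Integer.Divisibility as ℤD using ()
open import Data.Rational as ℚ using (ℚ; 0ℚ; 1ℚ; _/_)
open import Data.Rational.Properties using () renaming (_≟_ to _≟ℚ_)
open import Data.List using (List; []; _∷_; length; reverse; map; filter; foldr; upTo; drop)
open import Data.Product using (Σ; ∃; ∃-syntax; _×_; _,_)
open import Data.Sum using (_⊎_)
open import Relation.Nullary using (¬_; yes; no)
open import Relation.Binary.PropositionalEquality using (_≡_; _≢_)

-- Polynomials over ℚ, as little-endian coefficient lists.
-- Equality of polynomials is coefficientwise (trailing zeros ignored).

Poly : Set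
Poly = List ℚ

coeff : Poly → ℕ → ℚ
coeff []       _       = 0ℚ
coeff (c ∷ _)  zero    = c
coeff (_ ∷ cs) (suc n) = coeff cs n

infix 4 _≈_
_≈_ : Poly → Poly → Set
p ≈ q = ∀ n → coeff p n ≡ coeff q n

const : ℚ → Poly
const c = c ∷ []

X : Poly
X = 0ℚ ∷ 1ℚ ∷ []

infixl 6 _+ₚ_ _-ₚ_
infixl 7 _*ₚ_ _·ₚ_

_+ₚ_ : Poly → Poly → Poly
[]       +ₚ q        = q
(a ∷ p)  +ₚ []       = a ∷ p
(a ∷ p)  +ₚ (b ∷ q)  = (a ℚ.+ b) ∷ (p +ₚ q)

_·ₚ_ : ℚ → Poly → Poly
c ·ₚ p = map (c ℚ.*_) p

negₚ : Poly → Poly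
negₚ p = map ℚ.-_ p

_-ₚ_ : Poly → Poly → Poly
p -ₚ q = p +ₚ negₚ q

_*ₚ_ : Poly → Poly → Poly
[]      *ₚ q = []
(a ∷ p) *ₚ q = (a ·ₚ q) +ₚ (0ℚ ∷ (p *ₚ q))

_^ₚ_ : Poly → ℕ → Poly
p ^ₚ zero  = const 1ℚ
p ^ₚ suc n = p *ₚ (p ^ₚ n)

_∘ₚ_ : Poly → Poly → Poly
p ∘ₚ s = foldr (λ c acc → const c +ₚ (s *ₚ acc)) [] p

eval : Poly → ℚ → ℚ
eval p a = foldr (λ c acc → c ℚ.+ a ℚ.* acc) 0ℚ p

ι : ℤ → ℚ
ι z = z / 1

infix 4 _∣ₚ_
_∣ₚ_ : Poly → Poly → Set
r ∣ₚ f = ∃[ g ] (r *ₚ g ≈ f)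

_≡_[mod_] : Poly → Poly → Poly → Set
f ≡ g [mod r ] = r ∣ₚ (f -ₚ g)

IsZeroPoly : Poly → Set
IsZeroPoly p = ∀ n → coeff p n ≡ 0ℚ

IsConstant : Poly → Set
IsConstant p = ∀ n → 1 ≤ n → coeff p n ≡ 0ℚ

NonConstant : Poly → Set
NonConstant p = ¬ IsConstant p

Irreducible : Poly → Set
Irreducible p = NonConstant p ×
  (∀ a b → a *ₚ b ≈ p → IsConstant a ⊎ IsConstant b)

PosLeading : Poly → Set
PosLeading p = ∃[ d ] (0ℚ ℚ.< coeff p d × (∀ n → d < n → coeff p n ≡ 0ℚ))

IntValue : Poly → ℤ → ℤ → Set
IntValue f a z = eval f (ι a) ≡ ι z

RepresentsIntegers : Poly → Set
RepresentsIntegers f = ∃[ a ] ∃[ z ] IntValue f a z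

-- gcd { f(a) : a ∈ ℤ, f(a) ∈ ℤ } = 1 : the only natural number dividing
-- all integer values of f is 1
IntValuesCoprime : Poly → Set
IntValuesCoprime f =
  ∀ (d : ℕ) → (∀ a z → IntValue f a z → d ℕD.∣ ℤ.∣ z ∣) → d ≡ 1

RepresentsPrimes : Poly → Set
RepresentsPrimes f =
  NonConstant f × Irreducible f × RepresentsIntegers f ×
  PosLeading f × IntValuesCoprime f

-- Cyclotomic polynomials, computed by  Φ_k = (x^k - 1) / ∏_{d ∣ k, d < k} Φ_d
-- (exact division by a monic polynomial).

private
  subPrefix : List ℚ → List ℚ → List ℚ
  subPrefix []       _        = []
  subPrefix xs       []       = xs
  subPrefix (x ∷ xs) (y ∷ ys) = (x ℚ.- y) ∷ subPrefix xs ys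

  -- long division, big-endian: fuel, dividend, divisor without its leading 1;
  -- returns the quotient (big-endian)
  divH : ℕ → List ℚ → List ℚ → List ℚ
  divH zero    _        _  = []
  divH (suc n) []       _  = []
  divH (suc n) (c ∷ fs) gt with length fs <? length gt
  ... | yes _ = []
  ... | no  _ = c ∷ divH n (subPrefix fs (map (c ℚ.*_) gt)) gt

  dropZeros : List ℚ → List ℚ
  dropZeros []       = []
  dropZeros (c ∷ cs) with c ≟ℚ 0ℚ
  ... | yes _ = dropZeros cs
  ... | no  _ = c ∷ cs

  tail' : List ℚ → List ℚ
  tail' []       = []
  tail' (_ ∷ xs) = xs

quotMonic : Poly → Poly → Poly
quotMonic f g =
  reverse (divH (length f) (reverse f) (tail' (dropZeros (reverse g))))

xk-1 : ℕ → Poly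
xk-1 k = (X ^ₚ k) -ₚ const 1ℚ

properDivisors : ℕ → List ℕ
properDivisors k = filter (λ d → ℕD._∣?_ d k) (drop 1 (upTo k))

private
  cycF : ℕ → ℕ → Poly
  cycF zero    k = const 1ℚ
  cycF (suc f) k =
    quotMonic (xk-1 k) (foldr (λ d acc → cycF f d *ₚ acc) (const 1ℚ) (properDivisors k))

-- the k-th cyclotomic polynomial (for k ≥ 1)
Φ : ℕ → Poly
Φ k = cycF k k

CompleteFamily : ℕ → ℕ → Poly → Poly → Poly → Set
CompleteFamily k D t r q =
  ¬ IsZeroPoly t × ¬ IsZeroPoly r × ¬ IsZeroPoly q ×
  RepresentsPrimes r ×
  (∃[ p ] ∃[ n ] (1 ≤ n × RepresentsPrimes p × q ≈ p ^ₚ n)) ×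
  (∃[ h ] (h *ₚ r ≈ (q +ₚ const 1ℚ) -ₚ t)) ×
  (r ∣ₚ (Φ k ∘ₚ (t -ₚ const 1ℚ))) ×
  (∃[ y ] (const (+ D / 1) *ₚ (y *ₚ y) ≈ (const (+ 4 / 1) *ₚ q) -ₚ (t *ₚ t)))

SquareFree : ℕ → Set
SquareFree D = ∀ (m : ℕ) → (m ℕ.* m) ℕD.∣ D → m ≡ 1

-- The field ℚ(√-D), as pairs (a , b) ↦ a + b√-D, and embeddings of it
-- into ℚ[x]/(r(x)) (elements of the quotient represented by polynomials,
-- equality being congruence modulo r).

QD : Set
QD = ℚ × ℚ

module _ (D : ℕ) where
  QD-one : QD
  QD-one = 1ℚ , 0ℚ

  QD-add : QD → QD → QD
  QD-add (a , b) (c , d) = (a ℚ.+ c) , (b ℚ.+ d)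

  QD-mul : QD → QD → QD
  QD-mul (a , b) (c , d) =
    (a ℚ.* c ℚ.- (+ D / 1) ℚ.* (b ℚ.* d)) , (a ℚ.* d ℚ.+ b ℚ.* c)

FieldEmbedding : ℕ → Poly → (QD → Poly) → Set
FieldEmbedding D r φ =
  (φ (QD-one D) ≡ const 1ℚ [mod r ]) ×
  (∀ u v → φ (QD-add D u v) ≡ φ u +ₚ φ v [mod r ]) ×
  (∀ u v → φ (QD-mul D u v) ≡ φ u *ₚ φ v [mod r ]) ×
  (∀ u v → φ u ≡ φ v [mod r ] → u ≡ v)

{-# OPTIONS --safe #-}
-- As r is irreducible, ℚ[x]/(r) is a field. Substituting q = h r + t - 1 into D y² = 4 q - t²
-- gives (t - 2)² + D y² ≡ 0 modulo r. If t ≡ 2 then Φ k (t - 1) ≡ Φ k (1), a non-zero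
-- constant for k ≥ 2, contradicting r ∣ Φ k (t - 1); so t - 2 and then y are invertible, and
-- e = (t - 2)/y satisfies e² ≡ -D, whence a + b√-D ↦ a + b e embeds ℚ(√-D).
--
-- Most of the work is Φ k (1) ≠ 0 for the cyclotomic polynomials as Defs computes them, by
-- exact division of x^k - 1 by ∏ Φ d over the proper divisors d of k. By strong induction,
-- the Φ d are monic and pairwise coprime (Φ d divides (x^d - 1)/(x^c - 1) ≡ d/c modulo
-- x^c - 1, where c = gcd(d, e) is an exponent combination of d and e), so the product divides
-- x^k - 1 and Φ k ∏ Φ d = x^k - 1. Cancelling Φ 1 = x - 1 leaves Φ k P = 1 + x + ... + x^(k-1),
-- which is k ≠ 0 at x = 1.
module Submission where

open import Defs
open import Data.Nat as ℕ using (ℕ; zero; suc; _<_; _≤_; _<?_; _∸_; z≤n; s≤s)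
import Data.Nat.Properties as ℕP
open import Data.Nat.Divisibility using (_∣?_; ∣⇒≤) renaming (_∣_ to _∣ℕ_)
import Data.Nat.Divisibility as ℕD
open import Data.Nat.GCD using (module GCD; module Bézout)
open import Data.Nat.Induction using (<-rec)
open import Data.Integer using (+_)
open import Data.Rational as ℚ using (ℚ; 0ℚ; 1ℚ; _+_; _*_; -_; _-_; _/_)
import Data.Rational.Properties as ℚP
open import Data.List using (List; []; _∷_; _++_; length; reverse; foldr; filter; applyUpTo)
import Data.List.Properties as LP
open import Data.List.Relation.Unary.All as All using (All; []; _∷_)
import Data.List.Relation.Unary.All.Properties as AllP
open import Data.List.Relation.Unary.AllPairs using (AllPairs; []; _∷_)
import Data.List.Relation.Unary.AllPairs.Properties as AllPairsP
open import Data.Bool using (true; false)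
open import Data.Maybe using (Maybe; nothing; just)
open import Data.Product using (∃; ∃-syntax; _×_; _,_; proj₁; proj₂)
open import Data.Sum using (_⊎_; inj₁; inj₂)
open import Data.Empty using (⊥; ⊥-elim)
open import Function using (_∘_; _∋_)
open import Level using (0ℓ)
open import Relation.Nullary using (¬_; Dec; yes; no; does)
open import Relation.Unary using (Pred; Decidable)
open import Relation.Binary.Definitions using (tri<; tri≈; tri>)
open import Relation.Binary.PropositionalEquality
import Relation.Binary.Reasoning.Setoid
open import Algebra.Bundles using (CommutativeRing)
open import Algebra.Properties.Group ℚP.+-0-group using (x∙y⁻¹≈ε⇒x≈y; ⁻¹-involutive)
open import Tactic.RingSolver using (solve-∀)
open import Tactic.RingSolver.Core.AlmostCommutativeRing using (AlmostCommutativeRing; fromCommutativeRing)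

-- The ring ℚ[x]

ℚ-ring : AlmostCommutativeRing _ _
ℚ-ring = fromCommutativeRing ℚP.+-*-commutativeRing isZero
  where
  isZero : ∀ x → Maybe (0ℚ ≡ x)
  isZero x with 0ℚ ℚP.≟ x
  ... | yes p = just p
  ... | no _  = nothing

coeff-+ : ∀ p q n → coeff (p +ₚ q) n ≡ coeff p n + coeff q n
coeff-+ []      q       n       = sym (ℚP.+-identityˡ _)
coeff-+ (a ∷ p) []      n       = sym (ℚP.+-identityʳ _)
coeff-+ (a ∷ p) (b ∷ q) zero    = refl
coeff-+ (a ∷ p) (b ∷ q) (suc n) = coeff-+ p q n

coeff-· : ∀ c p n → coeff (c ·ₚ p) n ≡ c * coeff p n
coeff-· c []      n       = sym (ℚP.*-zeroʳ c)
coeff-· c (a ∷ p) zero    = refl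
coeff-· c (a ∷ p) (suc n) = coeff-· c p n

coeff-neg : ∀ p n → coeff (negₚ p) n ≡ - coeff p n
coeff-neg []      n       = refl
coeff-neg (a ∷ p) zero    = refl
coeff-neg (a ∷ p) (suc n) = coeff-neg p n

coeff-- : ∀ p q n → coeff (p -ₚ q) n ≡ coeff p n - coeff q n
coeff-- p q n = trans (coeff-+ p (negₚ q) n) (cong (_+_ (coeff p n)) (coeff-neg q n))

conv : (ℕ → ℚ) → (ℕ → ℚ) → ℕ → ℚ
conv f g zero    = f 0 * g 0
conv f g (suc n) = f 0 * g (suc n) + conv (f ∘ suc) g n

conv-cong : ∀ {f f′ g g′} → (∀ n → f n ≡ f′ n) → (∀ n → g n ≡ g′ n) →
            ∀ n → conv f g n ≡ conv f′ g′ n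
conv-cong f≡ g≡ zero    = cong₂ _*_ (f≡ 0) (g≡ 0)
conv-cong f≡ g≡ (suc n) = cong₂ _+_ (cong₂ _*_ (f≡ 0) (g≡ (suc n))) (conv-cong (f≡ ∘ suc) g≡ n)

conv-zeroˡ : ∀ g n → conv (λ _ → 0ℚ) g n ≡ 0ℚ
conv-zeroˡ g zero    = ℚP.*-zeroˡ (g 0)
conv-zeroˡ g (suc n) = trans (cong₂ _+_ (ℚP.*-zeroˡ (g (suc n))) (conv-zeroˡ g n)) (ℚP.+-identityˡ 0ℚ)

conv-zeroʳ : ∀ f n → conv f (λ _ → 0ℚ) n ≡ 0ℚ
conv-zeroʳ f zero    = ℚP.*-zeroʳ (f 0)
conv-zeroʳ f (suc n) = trans (cong₂ _+_ (ℚP.*-zeroʳ (f 0)) (conv-zeroʳ (f ∘ suc) n)) (ℚP.+-identityˡ 0ℚ)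

coeff-* : ∀ p q n → coeff (p *ₚ q) n ≡ conv (coeff p) (coeff q) n
coeff-* []      q n       = sym (conv-zeroˡ (coeff q) n)
coeff-* (a ∷ p) q zero    =
  trans (coeff-+ (a ·ₚ q) (0ℚ ∷ (p *ₚ q)) 0) (trans (ℚP.+-identityʳ _) (coeff-· a q 0))
coeff-* (a ∷ p) q (suc n) =
  trans (coeff-+ (a ·ₚ q) (0ℚ ∷ (p *ₚ q)) (suc n)) (cong₂ _+_ (coeff-· a q (suc n)) (coeff-* p q n))

-- A record wrapping Defs' _≈_, so that both polynomials can be
-- recovered from a proof by unification.
infix 4 _≋_
record _≋_ (p q : Poly) : Set where
  constructor mk
  field get : p ≈ q
open _≋_ public

≋-refl : ∀ {p} → p ≋ p
≋-refl = mk λ _ → refl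

≋-sym : ∀ {p q} → p ≋ q → q ≋ p
≋-sym (mk e) = mk λ n → sym (e n)

≋-trans : ∀ {p q r} → p ≋ q → q ≋ r → p ≋ r
≋-trans (mk e) (mk f) = mk λ n → trans (e n) (f n)

≡⇒≋ : ∀ {p q} → p ≡ q → p ≋ q
≡⇒≋ refl = ≋-refl

+-cong : ∀ {p p′ q q′} → p ≋ p′ → q ≋ q′ → p +ₚ q ≋ p′ +ₚ q′
+-cong {p} {p′} {q} {q′} (mk e) (mk f) =
  mk λ n → trans (coeff-+ p q n) (trans (cong₂ _+_ (e n) (f n)) (sym (coeff-+ p′ q′ n)))

·-cong : ∀ c {p p′} → p ≋ p′ → c ·ₚ p ≋ c ·ₚ p′
·-cong c {p} {p′} (mk e) =
  mk λ n → trans (coeff-· c p n) (trans (cong (c *_) (e n)) (sym (coeff-· c p′ n)))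

neg-cong : ∀ {p p′} → p ≋ p′ → negₚ p ≋ negₚ p′
neg-cong {p} {p′} (mk e) =
  mk λ n → trans (coeff-neg p n) (trans (cong -_ (e n)) (sym (coeff-neg p′ n)))

∷-cong : ∀ a {p p′} → p ≋ p′ → a ∷ p ≋ a ∷ p′
∷-cong a (mk e) = mk λ { zero → refl ; (suc n) → e n }

*-cong : ∀ {p p′ q q′} → p ≋ p′ → q ≋ q′ → p *ₚ q ≋ p′ *ₚ q′
*-cong {p} {p′} {q} {q′} (mk e) (mk f) =
  mk λ n → trans (coeff-* p q n) (trans (conv-cong e f n) (sym (coeff-* p′ q′ n)))

*-zeroʳ : ∀ p → p *ₚ [] ≋ []
*-zeroʳ p = mk λ n → trans (coeff-* p [] n) (conv-zeroʳ (coeff p) n)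

+-assoc : ∀ p q r → (p +ₚ q) +ₚ r ≋ p +ₚ (q +ₚ r)
+-assoc p q r = mk λ n → begin
  coeff ((p +ₚ q) +ₚ r) n              ≡⟨ coeff-+ (p +ₚ q) r n ⟩
  coeff (p +ₚ q) n + coeff r n         ≡⟨ cong (_+ coeff r n) (coeff-+ p q n) ⟩
  (coeff p n + coeff q n) + coeff r n  ≡⟨ ℚP.+-assoc (coeff p n) (coeff q n) (coeff r n) ⟩
  coeff p n + (coeff q n + coeff r n)  ≡⟨ cong (_+_ (coeff p n)) (coeff-+ q r n) ⟨
  coeff p n + coeff (q +ₚ r) n         ≡⟨ coeff-+ p (q +ₚ r) n ⟨
  coeff (p +ₚ (q +ₚ r)) n              ∎
  where open ≡-Reasoning

+-comm : ∀ p q → p +ₚ q ≋ q +ₚ p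
+-comm p q = mk λ n →
  trans (coeff-+ p q n) (trans (ℚP.+-comm (coeff p n) (coeff q n)) (sym (coeff-+ q p n)))

+-identityˡ : ∀ p → [] +ₚ p ≋ p
+-identityˡ p = ≋-refl

+-identityʳ : ∀ p → p +ₚ [] ≋ p
+-identityʳ p = mk λ n → trans (coeff-+ p [] n) (ℚP.+-identityʳ (coeff p n))

+-inverseˡ : ∀ p → negₚ p +ₚ p ≋ []
+-inverseˡ p = mk λ n →
  trans (coeff-+ (negₚ p) p n) (trans (cong (_+ coeff p n) (coeff-neg p n)) (ℚP.+-inverseˡ (coeff p n)))

+-inverseʳ : ∀ p → p +ₚ negₚ p ≋ []
+-inverseʳ p = ≋-trans (+-comm p (negₚ p)) (+-inverseˡ p)

0∷-+ : ∀ p q → 0ℚ ∷ (p +ₚ q) ≋ (0ℚ ∷ p) +ₚ (0ℚ ∷ q)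
0∷-+ p q = mk λ { zero → sym (ℚP.+-identityʳ 0ℚ) ; (suc n) → refl }

+-interchange : ∀ a b c d → (a +ₚ b) +ₚ (c +ₚ d) ≋ (a +ₚ c) +ₚ (b +ₚ d)
+-interchange a b c d = mk λ n →
  trans (coeff-+ (a +ₚ b) (c +ₚ d) n) (trans (cong₂ _+_ (coeff-+ a b n) (coeff-+ c d n))
  (trans (interchange (coeff a n) (coeff b n) (coeff c n) (coeff d n))
  (sym (trans (coeff-+ (a +ₚ c) (b +ₚ d) n) (cong₂ _+_ (coeff-+ a c n) (coeff-+ b d n))))))
  where
  interchange : ∀ x y z w → (x + y) + (z + w) ≡ (x + z) + (y + w)
  interchange = solve-∀ ℚ-ring

·-distrib-+ : ∀ c p q → c ·ₚ (p +ₚ q) ≋ c ·ₚ p +ₚ c ·ₚ q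
·-distrib-+ c p q = mk λ n →
  trans (coeff-· c (p +ₚ q) n) (trans (cong (c *_) (coeff-+ p q n))
  (trans (ℚP.*-distribˡ-+ c (coeff p n) (coeff q n))
  (sym (trans (coeff-+ (c ·ₚ p) (c ·ₚ q) n) (cong₂ _+_ (coeff-· c p n) (coeff-· c q n))))))

·-assoc : ∀ c d p → c ·ₚ (d ·ₚ p) ≋ (c * d) ·ₚ p
·-assoc c d p = mk λ n → trans (coeff-· c (d ·ₚ p) n) (trans (cong (c *_) (coeff-· d p n))
  (trans (sym (ℚP.*-assoc c d (coeff p n))) (sym (coeff-· (c * d) p n))))

·-zero : ∀ p → 0ℚ ·ₚ p ≋ []
·-zero p = mk λ n → trans (coeff-· 0ℚ p n) (ℚP.*-zeroˡ (coeff p n))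

·-identity : ∀ p → 1ℚ ·ₚ p ≋ p
·-identity p = mk λ n → trans (coeff-· 1ℚ p n) (ℚP.*-identityˡ (coeff p n))

*-∷ : ∀ p b q → p *ₚ (b ∷ q) ≋ b ·ₚ p +ₚ (0ℚ ∷ (p *ₚ q))
*-∷ p b q = mk (go p)
  where
  swap : ∀ x y z → x + (y + z) ≡ y + (x + z)
  swap = solve-∀ ℚ-ring
  go : ∀ p → p *ₚ (b ∷ q) ≈ b ·ₚ p +ₚ (0ℚ ∷ (p *ₚ q))
  go []      zero    = sym (ℚP.+-identityʳ 0ℚ)
  go []      (suc n) = refl
  go (a ∷ p) zero    =
    trans (ℚP.+-identityʳ (a * b)) (trans (ℚP.*-comm a b) (sym (ℚP.+-identityʳ (b * a))))
  go (a ∷ p) (suc n) = begin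
    coeff (a ·ₚ (b ∷ q) +ₚ (0ℚ ∷ (p *ₚ (b ∷ q)))) (suc n)
      ≡⟨ coeff-+ (a ·ₚ (b ∷ q)) (0ℚ ∷ (p *ₚ (b ∷ q))) (suc n) ⟩
    coeff (a ·ₚ q) n + coeff (p *ₚ (b ∷ q)) n
      ≡⟨ cong (_+_ (coeff (a ·ₚ q) n)) (trans (go p n) (coeff-+ (b ·ₚ p) (0ℚ ∷ (p *ₚ q)) n)) ⟩
    coeff (a ·ₚ q) n + (coeff (b ·ₚ p) n + coeff (0ℚ ∷ (p *ₚ q)) n)
      ≡⟨ swap (coeff (a ·ₚ q) n) (coeff (b ·ₚ p) n) _ ⟩
    coeff (b ·ₚ p) n + (coeff (a ·ₚ q) n + coeff (0ℚ ∷ (p *ₚ q)) n)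
      ≡⟨ cong (_+_ (coeff (b ·ₚ p) n)) (coeff-+ (a ·ₚ q) (0ℚ ∷ (p *ₚ q)) n) ⟨
    coeff (b ·ₚ p) n + coeff (a ·ₚ q +ₚ (0ℚ ∷ (p *ₚ q))) n
      ≡⟨ coeff-+ (b ·ₚ (a ∷ p)) (0ℚ ∷ ((a ∷ p) *ₚ q)) (suc n) ⟨
    coeff (b ·ₚ (a ∷ p) +ₚ (0ℚ ∷ ((a ∷ p) *ₚ q))) (suc n)
      ∎
    where open ≡-Reasoning

*-comm : ∀ p q → p *ₚ q ≋ q *ₚ p
*-comm []      q = ≋-sym (*-zeroʳ q)
*-comm (a ∷ p) q = ≋-trans (+-cong (≋-refl {a ·ₚ q}) (∷-cong 0ℚ (*-comm p q))) (≋-sym (*-∷ q a p))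

*-distribˡ-+ : ∀ p q r → p *ₚ (q +ₚ r) ≋ p *ₚ q +ₚ p *ₚ r
*-distribˡ-+ []      q r = ≋-refl
*-distribˡ-+ (a ∷ p) q r =
  ≋-trans (+-cong (·-distrib-+ a q r) (≋-trans (∷-cong 0ℚ (*-distribˡ-+ p q r)) (0∷-+ (p *ₚ q) (p *ₚ r))))
          (+-interchange (a ·ₚ q) (a ·ₚ r) (0ℚ ∷ (p *ₚ q)) (0ℚ ∷ (p *ₚ r)))

*-distribʳ-+ : ∀ p q r → (q +ₚ r) *ₚ p ≋ q *ₚ p +ₚ r *ₚ p
*-distribʳ-+ p q r =
  ≋-trans (*-comm (q +ₚ r) p) (≋-trans (*-distribˡ-+ p q r) (+-cong (*-comm p q) (*-comm p r)))

·-*-assoc : ∀ c p q → (c ·ₚ p) *ₚ q ≋ c ·ₚ (p *ₚ q)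
·-*-assoc c []      q = ≋-refl
·-*-assoc c (a ∷ p) q =
  ≋-trans (+-cong (≋-sym (·-assoc c a q)) (≋-trans (∷-cong 0ℚ (·-*-assoc c p q)) ·-0∷))
          (≋-sym (·-distrib-+ c (a ·ₚ q) (0ℚ ∷ (p *ₚ q))))
  where
  ·-0∷ : 0ℚ ∷ (c ·ₚ (p *ₚ q)) ≋ c ·ₚ (0ℚ ∷ (p *ₚ q))
  ·-0∷ = mk λ { zero → sym (ℚP.*-zeroʳ c) ; (suc n) → refl }

0∷-* : ∀ p q → (0ℚ ∷ p) *ₚ q ≋ 0ℚ ∷ (p *ₚ q)
0∷-* p q = +-cong (·-zero q) ≋-refl

*-assoc : ∀ p q r → (p *ₚ q) *ₚ r ≋ p *ₚ (q *ₚ r)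
*-assoc []      q r = ≋-refl
*-assoc (a ∷ p) q r = ≋-trans (*-distribʳ-+ r (a ·ₚ q) (0ℚ ∷ (p *ₚ q)))
  (+-cong (·-*-assoc a q r) (≋-trans (0∷-* (p *ₚ q) r) (∷-cong 0ℚ (*-assoc p q r))))

*-identityˡ : ∀ p → const 1ℚ *ₚ p ≋ p
*-identityˡ p = ≋-trans (+-cong (·-identity p) (mk λ { zero → refl ; (suc n) → refl })) (+-identityʳ p)

*-identityʳ : ∀ p → p *ₚ const 1ℚ ≋ p
*-identityʳ p = ≋-trans (*-comm p (const 1ℚ)) (*-identityˡ p)

ℚ[x] : CommutativeRing _ _
ℚ[x] = record
  { Carrier = Poly ; _≈_ = _≋_ ; _+_ = _+ₚ_ ; _*_ = _*ₚ_ ; -_ = negₚ ; 0# = [] ; 1# = const 1ℚ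
  ; isCommutativeRing = record
    { isRing = record
      { +-isAbelianGroup = record
        { isGroup = record
          { isMonoid = record
            { isSemigroup = record
              { isMagma = record
                { isEquivalence = record { refl = ≋-refl ; sym = ≋-sym ; trans = ≋-trans }
                ; ∙-cong = +-cong }
              ; assoc = +-assoc }
            ; identity = +-identityˡ , +-identityʳ }
          ; inverse = +-inverseˡ , +-inverseʳ
          ; ⁻¹-cong = neg-cong }
        ; comm = +-comm }
      ; *-cong = *-cong
      ; *-assoc = *-assoc
      ; *-identity = *-identityˡ , *-identityʳ
      ; distrib = *-distribˡ-+ , *-distribʳ-+ }
    ; *-comm = *-comm } }

ℚ[x]-ring : AlmostCommutativeRing _ _
ℚ[x]-ring = fromCommutativeRing ℚ[x] isZero
  where
  isZero : ∀ p → Maybe ([] ≋ p)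
  isZero [] = just ≋-refl
  isZero (a ∷ p) with a ℚP.≟ 0ℚ | isZero p
  ... | yes refl | just (mk e) = just (mk λ { zero → refl ; (suc n) → e n })
  ... | _        | _           = nothing

module ≋-Reasoning = Relation.Binary.Reasoning.Setoid (CommutativeRing.setoid ℚ[x])

-- Degrees

*-nonZero : ∀ {x y : ℚ} → x ≢ 0ℚ → y ≢ 0ℚ → x * y ≢ 0ℚ
*-nonZero {x} {y} x≢0 y≢0 xy≡0 = y≢0 (begin
  y                ≡⟨ ℚP.*-identityˡ y ⟨
  1ℚ * y           ≡⟨ cong (_* y) (ℚP.*-inverseˡ x) ⟨
  (1/x * x) * y    ≡⟨ ℚP.*-assoc 1/x x y ⟩
  1/x * (x * y)    ≡⟨ cong (1/x *_) xy≡0 ⟩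
  1/x * 0ℚ         ≡⟨ ℚP.*-zeroʳ 1/x ⟩
  0ℚ               ∎)
  where
  open ≡-Reasoning
  instance _ = ℚ.≢-nonZero x≢0
  1/x = ℚ.1/ x

DegAtMost : Poly → ℕ → Set
DegAtMost p d = ∀ n → d < n → coeff p n ≡ 0ℚ

DegBelow : Poly → ℕ → Set
DegBelow p d = ∀ n → d ≤ n → coeff p n ≡ 0ℚ

HasDegree : Poly → ℕ → Set
HasDegree p d = coeff p d ≢ 0ℚ × DegAtMost p d

conv-top : ∀ a b (f g : ℕ → ℚ) → (∀ n → a < n → f n ≡ 0ℚ) → (∀ n → b < n → g n ≡ 0ℚ) →
           (∀ n → a ℕ.+ b < n → conv f g n ≡ 0ℚ) × (conv f g (a ℕ.+ b) ≡ f a * g b)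
conv-top zero b f g f↑ g↑ = above , at b
  where
  tail≡0 : ∀ m → conv (f ∘ suc) g m ≡ 0ℚ
  tail≡0 m = trans (conv-cong (λ n → f↑ (suc n) (s≤s z≤n)) (λ _ → refl) m) (conv-zeroˡ g m)
  above : ∀ n → b < n → conv f g n ≡ 0ℚ
  above (suc m) b<n = trans (cong₂ _+_ (trans (cong (f 0 *_) (g↑ (suc m) b<n)) (ℚP.*-zeroʳ (f 0))) (tail≡0 m))
                            (ℚP.+-identityˡ 0ℚ)
  at : ∀ b → conv f g b ≡ f 0 * g b
  at zero    = refl
  at (suc m) = trans (cong (_+_ (f 0 * g (suc m))) (tail≡0 m)) (ℚP.+-identityʳ _)
conv-top (suc a) b f g f↑ g↑ = above , at
  where
  ih = conv-top a b (f ∘ suc) g (λ n a<n → f↑ (suc n) (s≤s a<n)) g↑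
  head≡0 : ∀ m → b ≤ m → f 0 * g (suc m) ≡ 0ℚ
  head≡0 m b≤m = trans (cong (f 0 *_) (g↑ (suc m) (s≤s b≤m))) (ℚP.*-zeroʳ (f 0))
  above : ∀ n → suc a ℕ.+ b < n → conv f g n ≡ 0ℚ
  above (suc m) (s≤s lt) =
    trans (cong₂ _+_ (head≡0 m (ℕP.≤-trans (ℕP.m≤n+m b a) (ℕP.<⇒≤ lt))) (proj₁ ih m lt)) (ℚP.+-identityˡ 0ℚ)
  at : conv f g (suc (a ℕ.+ b)) ≡ f (suc a) * g b
  at = trans (cong₂ _+_ (head≡0 (a ℕ.+ b) (ℕP.m≤n+m b a)) (proj₂ ih)) (ℚP.+-identityˡ _)

*-DegAtMost : ∀ p q a b → DegAtMost p a → DegAtMost q b →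
              DegAtMost (p *ₚ q) (a ℕ.+ b) × (coeff (p *ₚ q) (a ℕ.+ b) ≡ coeff p a * coeff q b)
*-DegAtMost p q a b p↑ q↑ =
  (λ n lt → trans (coeff-* p q n) (proj₁ top n lt)) , trans (coeff-* p q (a ℕ.+ b)) (proj₂ top)
  where top = conv-top a b (coeff p) (coeff q) p↑ q↑

IsZeroPoly? : ∀ p → Dec (IsZeroPoly p)
IsZeroPoly? [] = yes λ _ → refl
IsZeroPoly? (a ∷ p) with a ℚP.≟ 0ℚ | IsZeroPoly? p
... | yes a≡0 | yes p≡0 = yes λ { zero → a≡0 ; (suc n) → p≡0 n }
... | no  a≢0 | _       = no λ z → a≢0 (z 0)
... | _       | no  p≢0 = no λ z → p≢0 (z ∘ suc)

degree : ∀ p → ¬ IsZeroPoly p → ∃[ d ] HasDegree p d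
degree []      p≢0 = ⊥-elim (p≢0 λ _ → refl)
degree (a ∷ p) p≢0 with IsZeroPoly? p
... | no  p′≢0 = let (d , c , b) = degree p p′≢0 in suc d , c , λ { (suc n) (s≤s lt) → b n lt }
... | yes p′≡0 = 0 , (λ a≡0 → p≢0 λ { zero → a≡0 ; (suc n) → p′≡0 n }) , λ { (suc n) _ → p′≡0 n }

HasDegree-resp : ∀ {p q d} → p ≋ q → HasDegree p d → HasDegree q d
HasDegree-resp (mk e) (c , b) = (λ z → c (trans (e _) z)) , (λ n lt → trans (sym (e n)) (b n lt))

HasDegree-* : ∀ p q a b → HasDegree p a → HasDegree q b → HasDegree (p *ₚ q) (a ℕ.+ b)
HasDegree-* p q a b (cp , bp) (cq , bq) = (λ e → *-nonZero cp cq (trans (sym (proj₂ m)) e)) , proj₁ m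
  where m = *-DegAtMost p q a b bp bq

HasDegree-unique : ∀ p a b → HasDegree p a → HasDegree p b → a ≡ b
HasDegree-unique p a b (ca , ba) (cb , bb) with ℕP.<-cmp a b
... | tri< a<b _ _ = ⊥-elim (cb (ba b a<b))
... | tri≈ _ a≡b _ = a≡b
... | tri> _ _ b<a = ⊥-elim (ca (bb a b<a))

*-nonZeroPoly : ∀ p q → ¬ IsZeroPoly p → ¬ IsZeroPoly q → ¬ IsZeroPoly (p *ₚ q)
*-nonZeroPoly p q p≢0 q≢0 pq≡0 =
  let (a , pa) = degree p p≢0 ; (b , qb) = degree q q≢0
  in proj₁ (HasDegree-* p q a b pa qb) (pq≡0 (a ℕ.+ b))

*-cancelʳ : ∀ a b c → ¬ IsZeroPoly c → a *ₚ c ≋ b *ₚ c → a ≋ b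
*-cancelʳ a b c c≢0 ac≋bc with IsZeroPoly? (a -ₚ b)
... | yes a-b≡0 = ≋-trans (≋-sym (a-b+b a b)) (+-cong (mk a-b≡0) (≋-refl {b}))
  where
  a-b+b : ∀ a b → (a -ₚ b) +ₚ b ≋ a
  a-b+b = solve-∀ ℚ[x]-ring
... | no  a-b≢0 = ⊥-elim (*-nonZeroPoly (a -ₚ b) c a-b≢0 c≢0
                    (get (≋-trans (distrib a b c) (≋-trans (+-cong ac≋bc ≋-refl) (+-inverseʳ (b *ₚ c))))))
  where
  distrib : ∀ a b c → (a -ₚ b) *ₚ c ≋ a *ₚ c -ₚ b *ₚ c
  distrib = solve-∀ ℚ[x]-ring

IsConstant⇒≋const : ∀ p → IsConstant p → p ≋ const (coeff p 0)
IsConstant⇒≋const p c = mk λ { zero → refl ; (suc n) → c (suc n) (s≤s z≤n) }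

*≋const⇒IsConstant : ∀ r g c → c ≢ 0ℚ → r *ₚ g ≋ const c → IsConstant r
*≋const⇒IsConstant r g c c≢0 rg≋c with IsZeroPoly? r | IsZeroPoly? g
... | yes r≡0 | _ = ⊥-elim (c≢0 (trans (sym (get rg≋c 0))
      (trans (coeff-* r g 0) (trans (conv-cong {coeff r} {λ _ → 0ℚ} {coeff g} r≡0 (λ _ → refl) 0)
                                    (conv-zeroˡ (coeff g) 0)))))
... | no _ | yes g≡0 = ⊥-elim (c≢0 (trans (sym (get rg≋c 0))
      (trans (coeff-* r g 0) (trans (conv-cong {coeff r} {coeff r} {coeff g} {λ _ → 0ℚ} (λ _ → refl) g≡0 0)
                                    (conv-zeroʳ (coeff r) 0)))))
... | no r≢0 | no g≢0 with degree r r≢0 | degree g g≢0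
...   | zero  , rd | _ , _  = λ n 1≤n → proj₂ rd n 1≤n
...   | suc a , rd | b , gb = ⊥-elim (proj₁ (HasDegree-* r g (suc a) b rd gb) (get rg≋c (suc (a ℕ.+ b))))

DegBelow-length : ∀ p → DegBelow p (length p)
DegBelow-length []      n       _        = refl
DegBelow-length (a ∷ p) (suc n) (s≤s le) = DegBelow-length p n le

DegBelow-mono : ∀ {p a b} → a ≤ b → DegBelow p a → DegBelow p b
DegBelow-mono a≤b s n b≤n = s n (ℕP.≤-trans a≤b b≤n)

HasDegree<DegBelow : ∀ {p d N} → HasDegree p d → DegBelow p N → d < N
HasDegree<DegBelow {d = d} {N} (c , _) s with ℕP.<-cmp d N
... | tri< lt _ _ = lt
... | tri≈ _ e _  = ⊥-elim (c (s d (ℕP.≤-reflexive (sym e))))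
... | tri> _ _ gt = ⊥-elim (c (s d (ℕP.<⇒≤ gt)))

monomial : ℚ → ℕ → Poly
monomial c zero    = c ∷ []
monomial c (suc j) = 0ℚ ∷ monomial c j

monomial-DegAtMost : ∀ c j → DegAtMost (monomial c j) j
monomial-DegAtMost c zero    (suc n) _        = refl
monomial-DegAtMost c (suc j) (suc n) (s≤s lt) = monomial-DegAtMost c j n lt

coeff-monomial : ∀ c j → coeff (monomial c j) j ≡ c
coeff-monomial c zero    = refl
coeff-monomial c (suc j) = coeff-monomial c j

IsZeroPoly-resp : ∀ {p q} → p ≋ q → IsZeroPoly p → IsZeroPoly q
IsZeroPoly-resp (mk e) p≡0 n = trans (sym (e n)) (p≡0 n)

-- Divisibility and Euclid's algorithm

infix 4 _∣_
record _∣_ (r f : Poly) : Set where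
  constructor divides
  field
    quotient : Poly
    equation : r *ₚ quotient ≋ f
open _∣_ public

∣⇒∣ₚ : ∀ {r f} → r ∣ f → r ∣ₚ f
∣⇒∣ₚ (divides g e) = g , get e

∣ₚ⇒∣ : ∀ {r f} → r ∣ₚ f → r ∣ f
∣ₚ⇒∣ (g , e) = divides g (mk e)

∣-resp : ∀ {r f f′} → f ≋ f′ → r ∣ f → r ∣ f′
∣-resp e (divides g x) = divides g (≋-trans x e)

∣-refl : ∀ {r} → r ∣ r
∣-refl {r} = divides (const 1ℚ) (*-identityʳ r)

∣-zero : ∀ {r f} → f ≋ [] → r ∣ f
∣-zero {r} f≋0 = divides [] (≋-trans (*-zeroʳ r) (≋-sym f≋0))

∣-+ : ∀ {r a b} → r ∣ a → r ∣ b → r ∣ a +ₚ b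
∣-+ {r} (divides g x) (divides h y) = divides (g +ₚ h) (≋-trans (*-distribˡ-+ r g h) (+-cong x y))

∣-*ʳ : ∀ {r a} b → r ∣ a → r ∣ a *ₚ b
∣-*ʳ {r} b (divides g x) = divides (g *ₚ b) (≋-trans (≋-sym (*-assoc r g b)) (*-cong x ≋-refl))

∣-*ˡ : ∀ {r a} b → r ∣ a → r ∣ b *ₚ a
∣-*ˡ {r} {a} b d = ∣-resp (*-comm a b) (∣-*ʳ b d)

∣-neg : ∀ {r a} → r ∣ a → r ∣ negₚ a
∣-neg {r} (divides g x) = divides (negₚ g) (≋-trans (*-neg r g) (neg-cong x))
  where
  *-neg : ∀ r g → r *ₚ negₚ g ≋ negₚ (r *ₚ g)
  *-neg = solve-∀ ℚ[x]-ring

∣-- : ∀ {r a b} → r ∣ a → r ∣ b → r ∣ a -ₚ b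
∣-- r∣a r∣b = ∣-+ r∣a (∣-neg r∣b)

∣-trans : ∀ {a b c} → a ∣ b → b ∣ c → a ∣ c
∣-trans {a} (divides g x) (divides h y) =
  divides (g *ₚ h) (≋-trans (≋-sym (*-assoc a g h)) (≋-trans (*-cong x ≋-refl) y))

∣-· : ∀ {r a} c → r ∣ a → r ∣ c ·ₚ a
∣-· {r} c (divides g x) = divides (c ·ₚ g) (≋-trans *-· (·-cong c x))
  where
  *-· : r *ₚ (c ·ₚ g) ≋ c ·ₚ (r *ₚ g)
  *-· = ≋-trans (*-comm r (c ·ₚ g)) (≋-trans (·-*-assoc c g r) (·-cong c (*-comm g r)))

const-* : ∀ a b → const a *ₚ const b ≋ const (a * b)
const-* a b = mk λ { zero → ℚP.+-identityʳ (a * b) ; (suc n) → ℚP.+-identityˡ 0ℚ }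

const-cong : ∀ {a b} → a ≡ b → const a ≋ const b
const-cong refl = ≋-refl

const-zero : const 0ℚ ≋ []
const-zero = mk λ { zero → refl ; (suc n) → refl }

·≋const-* : ∀ c p → c ·ₚ p ≋ const c *ₚ p
·≋const-* c p = ≋-sym (≋-trans (+-cong ≋-refl const-zero) (+-identityʳ (c ·ₚ p)))

NonConstant-∤const : ∀ {r} c → NonConstant r → c ≢ 0ℚ → ¬ (r ∣ const c)
NonConstant-∤const {r} c r-nc c≢0 (divides g e) = r-nc (*≋const⇒IsConstant r g c c≢0 e)

DivisionWithRemainder : Poly → Poly → ℕ → Set
DivisionWithRemainder f g d = ∃[ Q ] ∃[ R ] (f ≋ Q *ₚ g +ₚ R × DegBelow R d)

-- Fuel N bounds the length of f; each step kills its coefficient of x^(N-1).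
divisionWithRemainder : ∀ N f g d → HasDegree g d → DegBelow f N → DivisionWithRemainder f g d
divisionWithRemainder N f g d gd f<N with N ℕP.≤? d
... | yes N≤d = [] , f , ≋-refl , DegBelow-mono {f} N≤d f<N
divisionWithRemainder zero    f g d gd f<N | no N≰d = ⊥-elim (N≰d z≤n)
divisionWithRemainder (suc M) f g d gd f<N | no N≰d = Q′ +ₚ m , R , f≋ , R<d
  where
  d≤M : d ≤ M
  d≤M = ℕP.≤-pred (ℕP.≰⇒> N≰d)
  l = coeff g d
  instance _ = ℚ.≢-nonZero (proj₁ gd)
  j = M ∸ d
  j+d≡M : j ℕ.+ d ≡ M
  j+d≡M = ℕP.m∸n+n≡m d≤M
  m = monomial (coeff f M * ℚ.1/ l) j
  mg = *-DegAtMost m g j d (monomial-DegAtMost _ j) (proj₂ gd)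
  top : coeff (m *ₚ g) M ≡ coeff f M
  top = begin
    coeff (m *ₚ g) M               ≡⟨ cong (coeff (m *ₚ g)) j+d≡M ⟨
    coeff (m *ₚ g) (j ℕ.+ d)       ≡⟨ proj₂ mg ⟩
    coeff m j * l                  ≡⟨ cong (_* l) (coeff-monomial _ j) ⟩
    (coeff f M * ℚ.1/ l) * l       ≡⟨ ℚP.*-assoc (coeff f M) (ℚ.1/ l) l ⟩
    coeff f M * (ℚ.1/ l * l)       ≡⟨ cong (coeff f M *_) (ℚP.*-inverseˡ l) ⟩
    coeff f M * 1ℚ                 ≡⟨ ℚP.*-identityʳ (coeff f M) ⟩
    coeff f M                      ∎
    where open ≡-Reasoning
  f′<M : DegBelow (f -ₚ m *ₚ g) M
  f′<M n M≤n with ℕP.m≤n⇒m<n∨m≡n M≤n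
  ... | inj₁ M<n = trans (coeff-- f (m *ₚ g) n)
        (trans (cong₂ _-_ (f<N n M<n) (proj₁ mg n (subst (_< n) (sym j+d≡M) M<n))) (ℚP.+-inverseʳ 0ℚ))
  ... | inj₂ refl = trans (coeff-- f (m *ₚ g) M) (trans (cong (λ z → coeff f M - z) top) (ℚP.+-inverseʳ (coeff f M)))
  rec = divisionWithRemainder M (f -ₚ m *ₚ g) g d gd f′<M
  Q′ = proj₁ rec
  R = proj₁ (proj₂ rec)
  R<d = proj₂ (proj₂ (proj₂ rec))
  f≋ : f ≋ (Q′ +ₚ m) *ₚ g +ₚ R
  f≋ = ≋-trans (≋-sym (a-b+b f (m *ₚ g)))
       (≋-trans (+-cong (proj₁ (proj₂ (proj₂ rec))) ≋-refl) (regroup Q′ m g R))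
    where
    a-b+b : ∀ a b → (a -ₚ b) +ₚ b ≋ a
    a-b+b = solve-∀ ℚ[x]-ring
    regroup : ∀ Q m g R → (Q *ₚ g +ₚ R) +ₚ m *ₚ g ≋ (Q +ₚ m) *ₚ g +ₚ R
    regroup = solve-∀ ℚ[x]-ring

DegBelow-multiple : ∀ g d h → HasDegree g d → DegBelow (g *ₚ h) d → IsZeroPoly h
DegBelow-multiple g d h gd gh<d with IsZeroPoly? h
... | yes h≡0 = h≡0
... | no  h≢0 = let (b , hb) = degree h h≢0
                in ⊥-elim (proj₁ (HasDegree-* g h d b gd hb) (gh<d (d ℕ.+ b) (ℕP.m≤m+n d b)))

record CommonDivisorCombination (f g : Poly) : Set where
  field
    divisor : Poly
    ∣f      : divisor ∣ f
    ∣g      : divisor ∣ g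
    u v     : Poly
    bezout  : divisor ≋ u *ₚ f +ₚ v *ₚ g

extendedGcd : ∀ N f g → DegBelow g N → CommonDivisorCombination f g
extendedGcd N f g g<N with IsZeroPoly? g
... | yes g≡0 = record
  { divisor = f ; ∣f = ∣-refl ; ∣g = ∣-zero (mk g≡0) ; u = const 1ℚ ; v = []
  ; bezout = ≋-sym (≋-trans (+-cong (*-identityˡ f) ≋-refl) (+-identityʳ f)) }
extendedGcd zero    f g g<N | no g≢0 = ⊥-elim (g≢0 λ n → g<N n z≤n)
extendedGcd (suc N) f g g<N | no g≢0 = record
  { divisor = divisor ; ∣f = ∣-resp (≋-sym f≋) (∣-+ (∣-*ˡ Q ∣f) ∣g) ; ∣g = ∣f
  ; u = v ; v = u -ₚ v *ₚ Q ; bezout = bezout′ }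
  where
  gd = proj₂ (degree g g≢0)
  qr = divisionWithRemainder (length f) f g _ gd (DegBelow-length f)
  Q = proj₁ qr
  R = proj₁ (proj₂ qr)
  f≋ = proj₁ (proj₂ (proj₂ qr))
  R<N : DegBelow R N
  R<N = DegBelow-mono {R} (ℕP.≤-pred (HasDegree<DegBelow {g} gd g<N)) (proj₂ (proj₂ (proj₂ qr)))
  open CommonDivisorCombination (extendedGcd N g R R<N)
  R≋ : R ≋ f -ₚ Q *ₚ g
  R≋ = ≋-trans (≋-sym (cancel Q g R)) (+-cong (≋-sym f≋) ≋-refl)
    where
    cancel : ∀ Q g R → (Q *ₚ g +ₚ R) -ₚ Q *ₚ g ≋ R
    cancel = solve-∀ ℚ[x]-ring
  bezout′ : divisor ≋ v *ₚ f +ₚ (u -ₚ v *ₚ Q) *ₚ g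
  bezout′ = ≋-trans bezout (≋-trans (+-cong (≋-refl {u *ₚ g}) (*-cong (≋-refl {v}) R≋)) (regroup u v g Q f))
    where
    regroup : ∀ u v g Q f → u *ₚ g +ₚ v *ₚ (f -ₚ Q *ₚ g) ≋ v *ₚ f +ₚ (u -ₚ v *ₚ Q) *ₚ g
    regroup = solve-∀ ℚ[x]-ring

-- ℚ[x]/(r) is a field: the gcd of r and a is a unit or an associate of r.
inverse-mod-irreducible : ∀ r a → Irreducible r → ¬ (r ∣ a) → ∃[ w ] (r ∣ w *ₚ a -ₚ const 1ℚ)
inverse-mod-irreducible r a (r-nc , r-irr) r∤a = from-factor (r-irr d b (get db))
  where
  open CommonDivisorCombination (extendedGcd (length r) a r (DegBelow-length r))
    renaming (divisor to d; ∣f to d∣a; bezout to d≋)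
  b = quotient ∣g
  db = equation ∣g
  r≋0⇒⊥ : r ≋ [] → ⊥
  r≋0⇒⊥ (mk r≡0) = r-nc λ n _ → r≡0 n
  from-factor : IsConstant d ⊎ IsConstant b → ∃[ w ] (r ∣ w *ₚ a -ₚ const 1ℚ)
  from-factor (inj₁ d-c) with coeff d 0 ℚP.≟ 0ℚ
  ... | yes c≡0 = ⊥-elim (r≋0⇒⊥ (≋-trans (≋-sym db)
        (≋-trans (*-cong (≋-trans (IsConstant⇒≋const d d-c) (≋-trans (const-cong c≡0) const-zero)) ≋-refl) ≋-refl)))
  ... | no  c≢0 = c⁻¹ ·ₚ u , ∣-resp eq (∣-neg (∣-· c⁻¹ (∣-*ˡ v (∣-refl {r}))))
    where
    instance _ = ℚ.≢-nonZero c≢0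
    c⁻¹ = ℚ.1/ coeff d 0
    one≋ : c⁻¹ ·ₚ (u *ₚ a) +ₚ c⁻¹ ·ₚ (v *ₚ r) ≋ const 1ℚ
    one≋ = ≋-trans (≋-sym (·-distrib-+ c⁻¹ (u *ₚ a) (v *ₚ r)))
           (≋-trans (·-cong c⁻¹ (≋-sym d≋)) (≋-trans (·-cong c⁻¹ (IsConstant⇒≋const d d-c))
           (const-cong (ℚP.*-inverseˡ (coeff d 0)))))
    eq : negₚ (c⁻¹ ·ₚ (v *ₚ r)) ≋ (c⁻¹ ·ₚ u) *ₚ a -ₚ const 1ℚ
    eq = ≋-trans (cancel (c⁻¹ ·ₚ (u *ₚ a)) (c⁻¹ ·ₚ (v *ₚ r))) (+-cong (≋-sym (·-*-assoc c⁻¹ u a)) (neg-cong one≋))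
      where
      cancel : ∀ x y → negₚ y ≋ x -ₚ (x +ₚ y)
      cancel = solve-∀ ℚ[x]-ring
  from-factor (inj₂ b-c) with coeff b 0 ℚP.≟ 0ℚ
  ... | yes c≡0 = ⊥-elim (r≋0⇒⊥ (≋-trans (≋-sym db)
        (≋-trans (*-cong (≋-refl {d}) (≋-trans (IsConstant⇒≋const b b-c) (≋-trans (const-cong c≡0) const-zero))) (*-zeroʳ d))))
  ... | no  c≢0 = ⊥-elim (r∤a (∣-trans r∣d d∣a))
    where
    instance _ = ℚ.≢-nonZero c≢0
    c⁻¹ = ℚ.1/ coeff b 0
    r∣d : r ∣ d
    r∣d = divides (const c⁻¹) (≋-trans (*-cong (≋-sym db) ≋-refl) (≋-trans (*-assoc d b (const c⁻¹))
          (≋-trans (*-cong (≋-refl {d}) (≋-trans (*-cong (IsConstant⇒≋const b b-c) ≋-refl)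
          (≋-trans (const-* (coeff b 0) c⁻¹) (const-cong (ℚP.*-inverseʳ (coeff b 0)))))) (*-identityʳ d))))

-- Exact division by a monic polynomial

-- Handles on the private helpers behind quotMonic in Defs: each is a metavariable, solved by
-- unification against the equation proved next to it (the 'with' clauses generalise the
-- arguments to variables so that these are pattern problems). In Defs' terms,
-- revDivH n fs gs acc = reverse (divH n fs gs) ++ acc, divisorTail = tail' ∘ dropZeros and
-- subtractScaled fs c gs = subPrefix fs (map (c *_) gs).
mutual
  revDivH : ℕ → List ℚ → List ℚ → List ℚ → List ℚ
  revDivH = _

  private
    quotMonic-unfold′ : ∀ f g d gs → reverse g ≡ d ∷ gs → d ≢ 0ℚ →
                        quotMonic f g ≡ revDivH (length f) (reverse f) gs []
    quotMonic-unfold′ f g d gs e d≢0 with length f | reverse f | reverse g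
    quotMonic-unfold′ f g d gs refl d≢0 | n | fs | .(d ∷ gs) with d ℚP.≟ 0ℚ
    ... | yes d≡0 = ⊥-elim (d≢0 d≡0)
    ... | no _ with List ℚ ∋ []
    ...   | acc = refl

mutual
  divisorTail : List ℚ → List ℚ
  divisorTail = _

  quotMonic-unfold : ∀ f g → quotMonic f g ≡ revDivH (length f) (reverse f) (divisorTail (reverse g)) []
  quotMonic-unfold f g with length f | reverse f | reverse g
  ... | n | fs | gr with List ℚ ∋ []
  ...   | acc = refl

mutual
  subtractScaled : List ℚ → ℚ → List ℚ → List ℚ
  subtractScaled = _

  revDivH-step : ∀ n c fs gs acc → ¬ (length fs < length gs) →
                 revDivH (suc n) (c ∷ fs) gs acc ≡ revDivH n (subtractScaled fs c gs) gs (c ∷ acc)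
  revDivH-step n c fs gs acc ¬lt with length fs <? length gs
  ... | yes lt = ⊥-elim (¬lt lt)
  ... | no _   = refl

revDivH-stop : ∀ n c fs gs acc → length fs < length gs → revDivH (suc n) (c ∷ fs) gs acc ≡ acc
revDivH-stop n c fs gs acc lt with length fs <? length gs
... | yes _  = refl
... | no ¬lt = ⊥-elim (¬lt lt)

divisorTail-∷ : ∀ d gs → d ≢ 0ℚ → divisorTail (d ∷ gs) ≡ gs
divisorTail-∷ d gs d≢0 with d ℚP.≟ 0ℚ
... | yes d≡0 = ⊥-elim (d≢0 d≡0)
... | no _    = refl

divisorTail-0∷ : ∀ d gs → d ≡ 0ℚ → divisorTail (d ∷ gs) ≡ divisorTail gs
divisorTail-0∷ d gs d≡0 with d ℚP.≟ 0ℚ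
... | yes _   = refl
... | no d≢0  = ⊥-elim (d≢0 d≡0)

private
  cycF-handle : ∀ f → ∃ λ (G : ℕ → Poly → Poly) →
                Φ (suc f) ≡ quotMonic (xk-1 (suc f)) (foldr G (const 1ℚ) (properDivisors (suc f)))
  cycF-handle f = _ , refl

cycF-factor : ℕ → ℕ → Poly → Poly
cycF-factor f = proj₁ (cycF-handle f)

-- Defs' cycF: Φ with an explicit recursion fuel.
cycF : ℕ → ℕ → Poly
cycF zero    d = const 1ℚ
cycF (suc f) d = quotMonic (xk-1 d) (foldr (cycF-factor f) (const 1ℚ) (properDivisors d))

cycF-factor-≡ : ∀ f d acc → cycF-factor f d acc ≡ cycF f d *ₚ acc
cycF-factor-≡ zero    d acc = refl
cycF-factor-≡ (suc f) d acc = refl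

revDivH-acc : ∀ n fs gs acc → revDivH n fs gs acc ≡ revDivH n fs gs [] ++ acc
revDivH-acc zero    fs       gs acc = refl
revDivH-acc (suc n) []       gs acc = refl
revDivH-acc (suc n) (c ∷ fs) gs acc = by-cases (length fs <? length gs)
  where
  open ≡-Reasoning
  S = subtractScaled fs c gs
  by-cases : Dec (length fs < length gs) → revDivH (suc n) (c ∷ fs) gs acc ≡ revDivH (suc n) (c ∷ fs) gs [] ++ acc
  by-cases (yes lt) = trans (revDivH-stop n c fs gs acc lt) (cong (_++ acc) (sym (revDivH-stop n c fs gs [] lt)))
  by-cases (no ¬lt) = begin
    revDivH (suc n) (c ∷ fs) gs acc      ≡⟨ revDivH-step n c fs gs acc ¬lt ⟩
    revDivH n S gs (c ∷ acc)             ≡⟨ revDivH-acc n S gs (c ∷ acc) ⟩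
    revDivH n S gs [] ++ (c ∷ acc)       ≡⟨ LP.++-assoc (revDivH n S gs []) (c ∷ []) acc ⟨
    (revDivH n S gs [] ++ c ∷ []) ++ acc ≡⟨ cong (_++ acc) (revDivH-acc n S gs (c ∷ [])) ⟨
    revDivH n S gs (c ∷ []) ++ acc       ≡⟨ cong (_++ acc) (revDivH-step n c fs gs [] ¬lt) ⟨
    revDivH (suc n) (c ∷ fs) gs [] ++ acc ∎

subtractScaled-length : ∀ fs c gs → length (subtractScaled fs c gs) ≡ length fs
subtractScaled-length []       c gs       = refl
subtractScaled-length (x ∷ xs) c []       = refl
subtractScaled-length (x ∷ xs) c (y ∷ ys) = cong suc (subtractScaled-length xs c ys)

revDivH-length : ∀ n fs gs → length fs ≤ n → length (revDivH n fs gs []) ≡ length fs ∸ length gs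
revDivH-length zero    []       gs _        = sym (ℕP.0∸n≡0 (length gs))
revDivH-length (suc n) []       gs _        = sym (ℕP.0∸n≡0 (length gs))
revDivH-length (suc n) (c ∷ fs) gs (s≤s fs≤n) = by-cases (length fs <? length gs)
  where
  open ≡-Reasoning
  S = subtractScaled fs c gs
  by-cases : Dec (length fs < length gs) → length (revDivH (suc n) (c ∷ fs) gs []) ≡ suc (length fs) ∸ length gs
  by-cases (yes lt) = trans (cong length (revDivH-stop n c fs gs [] lt)) (sym (ℕP.m≤n⇒m∸n≡0 lt))
  by-cases (no ¬lt) = begin
    length (revDivH (suc n) (c ∷ fs) gs [])   ≡⟨ cong length (trans (revDivH-step n c fs gs [] ¬lt) (revDivH-acc n S gs (c ∷ []))) ⟩
    length (revDivH n S gs [] ++ c ∷ [])      ≡⟨ LP.length-++ (revDivH n S gs []) ⟩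
    length (revDivH n S gs []) ℕ.+ 1          ≡⟨ cong (ℕ._+ 1) (revDivH-length n S gs (subst (_≤ n) (sym (subtractScaled-length fs c gs)) fs≤n)) ⟩
    (length S ∸ length gs) ℕ.+ 1              ≡⟨ cong (λ l → (l ∸ length gs) ℕ.+ 1) (subtractScaled-length fs c gs) ⟩
    (length fs ∸ length gs) ℕ.+ 1             ≡⟨ ℕP.+-comm (length fs ∸ length gs) 1 ⟩
    suc (length fs ∸ length gs)               ≡⟨ ℕP.+-∸-assoc 1 (ℕP.≮⇒≥ ¬lt) ⟨
    suc (length fs) ∸ length gs               ∎

shift : ℕ → Poly → Poly
shift zero    p = p
shift (suc i) p = 0ℚ ∷ shift i p

shift-cong : ∀ i {p q} → p ≋ q → shift i p ≋ shift i q
shift-cong zero    p≋q = p≋q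
shift-cong (suc i) p≋q = ∷-cong 0ℚ (shift-cong i p≋q)

monomial-* : ∀ a i p → monomial a i *ₚ p ≋ shift i (a ·ₚ p)
monomial-* a zero    p = ≋-trans (+-cong (≋-refl {a ·ₚ p}) const-zero) (+-identityʳ (a ·ₚ p))
monomial-* a (suc i) p = ≋-trans (0∷-* (monomial a i) p) (∷-cong 0ℚ (monomial-* a i p))

shift-monomial : ∀ i b j → shift i (monomial b j) ≡ monomial b (i ℕ.+ j)
shift-monomial zero    b j = refl
shift-monomial (suc i) b j = cong (0ℚ ∷_) (shift-monomial i b j)

·-monomial : ∀ a b j → a ·ₚ monomial b j ≋ monomial (a * b) j
·-monomial a b j = mk (go j)
  where
  go : ∀ j n → coeff (a ·ₚ monomial b j) n ≡ coeff (monomial (a * b) j) n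
  go zero    zero    = refl
  go zero    (suc n) = refl
  go (suc j) zero    = ℚP.*-zeroʳ a
  go (suc j) (suc n) = go j n

monomial-*-monomial : ∀ a i b j → monomial a i *ₚ monomial b j ≋ monomial (a * b) (i ℕ.+ j)
monomial-*-monomial a i b j =
  ≋-trans (monomial-* a i (monomial b j)) (≋-trans (shift-cong i (·-monomial a b j)) (≡⇒≋ (shift-monomial i (a * b) j)))

coeff-monomial-- : ∀ a b j n → coeff (monomial (a - b) j) n ≡ coeff (monomial a j) n - coeff (monomial b j) n
coeff-monomial-- a b zero    zero    = refl
coeff-monomial-- a b zero    (suc n) = sym (ℚP.+-inverseʳ 0ℚ)
coeff-monomial-- a b (suc j) zero    = sym (ℚP.+-inverseʳ 0ℚ)
coeff-monomial-- a b (suc j) (suc n) = coeff-monomial-- a b j n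

++-[c] : ∀ xs c → xs ++ c ∷ [] ≋ xs +ₚ monomial c (length xs)
++-[c] xs c = mk (go xs)
  where
  go : ∀ xs n → coeff (xs ++ c ∷ []) n ≡ coeff (xs +ₚ monomial c (length xs)) n
  go []       zero    = refl
  go []       (suc n) = refl
  go (x ∷ xs) zero    = sym (ℚP.+-identityʳ x)
  go (x ∷ xs) (suc n) = go xs n

reverse-∷ : ∀ c xs → reverse (c ∷ xs) ≋ reverse xs +ₚ monomial c (length xs)
reverse-∷ c xs = ≋-trans (≡⇒≋ (LP.unfold-reverse c xs))
  (≋-trans (++-[c] (reverse xs) c) (≡⇒≋ (cong (λ l → reverse xs +ₚ monomial c l) (LP.length-reverse xs))))

reverse-subtractScaled : ∀ fs c gs → length gs ≤ length fs →
  reverse (subtractScaled fs c gs) ≋ reverse fs -ₚ monomial c (length fs ∸ length gs) *ₚ reverse gs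
reverse-subtractScaled []       c []       _ =
  ≋-sym (≋-trans (+-cong (≋-refl {[]}) (neg-cong (*-zeroʳ (monomial c 0)))) (+-identityʳ []))
reverse-subtractScaled (x ∷ xs) c []       _ =
  ≋-sym (≋-trans (+-cong (≋-refl {reverse (x ∷ xs)}) (neg-cong (*-zeroʳ (monomial c (suc (length xs)))))) (+-identityʳ _))
reverse-subtractScaled (x ∷ xs) c (y ∷ ys) (s≤s ys≤xs) = begin
  reverse ((x - c * y) ∷ subtractScaled xs c ys)
    ≈⟨ reverse-∷ (x - c * y) (subtractScaled xs c ys) ⟩
  reverse (subtractScaled xs c ys) +ₚ monomial (x - c * y) (length (subtractScaled xs c ys))
    ≈⟨ +-cong (reverse-subtractScaled xs c ys ys≤xs) (≡⇒≋ (cong (monomial (x - c * y)) (subtractScaled-length xs c ys))) ⟩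
  (reverse xs -ₚ M *ₚ reverse ys) +ₚ monomial (x - c * y) (length xs)
    ≈⟨ +-cong (≋-refl {reverse xs -ₚ M *ₚ reverse ys}) top ⟩
  (reverse xs -ₚ M *ₚ reverse ys) +ₚ (monomial x (length xs) -ₚ M *ₚ monomial y (length ys))
    ≈⟨ regroup (reverse xs) M (reverse ys) (monomial x (length xs)) (monomial y (length ys)) ⟩
  (reverse xs +ₚ monomial x (length xs)) -ₚ M *ₚ (reverse ys +ₚ monomial y (length ys))
    ≈⟨ +-cong (reverse-∷ x xs) (neg-cong (*-cong (≋-refl {M}) (reverse-∷ y ys))) ⟨
  reverse (x ∷ xs) -ₚ M *ₚ reverse (y ∷ ys)
    ∎
  where
  open ≋-Reasoning
  M = monomial c (length xs ∸ length ys)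
  regroup : ∀ A M B X Y → (A -ₚ M *ₚ B) +ₚ (X -ₚ M *ₚ Y) ≋ (A +ₚ X) -ₚ M *ₚ (B +ₚ Y)
  regroup = solve-∀ ℚ[x]-ring
  M*y : M *ₚ monomial y (length ys) ≋ monomial (c * y) (length xs)
  M*y = ≋-trans (monomial-*-monomial c (length xs ∸ length ys) y (length ys))
                (≡⇒≋ (cong (monomial (c * y)) (ℕP.m∸n+n≡m ys≤xs)))
  top : monomial (x - c * y) (length xs) ≋ monomial x (length xs) -ₚ M *ₚ monomial y (length ys)
  top = mk λ n → trans (coeff-monomial-- x (c * y) (length xs) n)
                       (trans (cong (λ z → coeff (monomial x (length xs)) n - z) (sym (get M*y n)))
                              (sym (coeff-- (monomial x (length xs)) (M *ₚ monomial y (length ys)) n)))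

revDivH-correct : ∀ n fs gs → length fs ≤ n →
  ∃[ R ] (reverse fs ≋ revDivH n fs gs [] *ₚ reverse (1ℚ ∷ gs) +ₚ R × DegBelow R (length gs))
revDivH-correct zero    []       gs _ = [] , ≋-refl , λ _ _ → refl
revDivH-correct (suc n) []       gs _ = [] , ≋-refl , λ _ _ → refl
revDivH-correct (suc n) (c ∷ fs) gs (s≤s fs≤n) = by-cases (length fs <? length gs)
  where
  G = reverse (1ℚ ∷ gs)
  by-cases : Dec (length fs < length gs) →
    ∃[ R ] (reverse (c ∷ fs) ≋ revDivH (suc n) (c ∷ fs) gs [] *ₚ G +ₚ R × DegBelow R (length gs))
  by-cases (yes lt) =
    reverse (c ∷ fs) , ≡⇒≋ (cong (λ Q → Q *ₚ G +ₚ reverse (c ∷ fs)) (sym (revDivH-stop n c fs gs [] lt))) ,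
    DegBelow-mono {reverse (c ∷ fs)} (subst (_≤ length gs) (sym (LP.length-reverse (c ∷ fs))) lt)
                  (DegBelow-length (reverse (c ∷ fs)))
  by-cases (no ¬lt) = R , fs≋ , R<gs
    where
    gs≤fs = ℕP.≮⇒≥ ¬lt
    S = subtractScaled fs c gs
    S≤n = subst (_≤ n) (sym (subtractScaled-length fs c gs)) fs≤n
    ih = revDivH-correct n S gs S≤n
    R = proj₁ ih
    R<gs = proj₂ (proj₂ ih)
    Q = revDivH n S gs []
    M = monomial c (length fs ∸ length gs)
    Q′≋ : revDivH (suc n) (c ∷ fs) gs [] ≋ Q +ₚ M
    Q′≋ = ≋-trans (≡⇒≋ (trans (revDivH-step n c fs gs [] ¬lt) (revDivH-acc n S gs (c ∷ []))))
          (≋-trans (++-[c] Q c) (≡⇒≋ (cong (λ l → Q +ₚ monomial c l)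
            (trans (revDivH-length n S gs S≤n) (cong (_∸ length gs) (subtractScaled-length fs c gs))))))
    G≋ : G ≋ reverse gs +ₚ monomial 1ℚ (length gs)
    G≋ = reverse-∷ 1ℚ gs
    M*x^gs : M *ₚ monomial 1ℚ (length gs) ≋ monomial c (length fs)
    M*x^gs = ≋-trans (monomial-*-monomial c (length fs ∸ length gs) 1ℚ (length gs))
                     (≡⇒≋ (cong₂ monomial (ℚP.*-identityʳ c) (ℕP.m∸n+n≡m gs≤fs)))
    fs≋ : reverse (c ∷ fs) ≋ revDivH (suc n) (c ∷ fs) gs [] *ₚ G +ₚ R
    fs≋ = begin
      reverse (c ∷ fs)
        ≈⟨ reverse-∷ c fs ⟩
      reverse fs +ₚ monomial c (length fs)
        ≈⟨ +-cong (≋-trans (≋-sym (a-b+b (reverse fs) (M *ₚ reverse gs)))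
                           (+-cong (≋-sym (reverse-subtractScaled fs c gs gs≤fs)) ≋-refl)) (≋-sym M*x^gs) ⟩
      (reverse S +ₚ M *ₚ reverse gs) +ₚ M *ₚ monomial 1ℚ (length gs)
        ≈⟨ +-cong (+-cong (proj₁ (proj₂ ih)) ≋-refl) ≋-refl ⟩
      ((Q *ₚ G +ₚ R) +ₚ M *ₚ reverse gs) +ₚ M *ₚ monomial 1ℚ (length gs)
        ≈⟨ +-cong (+-cong (+-cong (*-cong (≋-refl {Q}) G≋) ≋-refl) ≋-refl) ≋-refl ⟩
      ((Q *ₚ (reverse gs +ₚ monomial 1ℚ (length gs)) +ₚ R) +ₚ M *ₚ reverse gs) +ₚ M *ₚ monomial 1ℚ (length gs)
        ≈⟨ regroup Q (reverse gs) (monomial 1ℚ (length gs)) R M ⟩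
      (Q +ₚ M) *ₚ (reverse gs +ₚ monomial 1ℚ (length gs)) +ₚ R
        ≈⟨ +-cong (*-cong Q′≋ G≋) ≋-refl ⟨
      revDivH (suc n) (c ∷ fs) gs [] *ₚ G +ₚ R
        ∎
      where
      open ≋-Reasoning
      a-b+b : ∀ a b → (a -ₚ b) +ₚ b ≋ a
      a-b+b = solve-∀ ℚ[x]-ring
      regroup : ∀ Q B X R M → ((Q *ₚ (B +ₚ X) +ₚ R) +ₚ M *ₚ B) +ₚ M *ₚ X ≋ (Q +ₚ M) *ₚ (B +ₚ X) +ₚ R
      regroup = solve-∀ ℚ[x]-ring

reverse-∷-HasDegree : ∀ l gs → l ≢ 0ℚ →
  HasDegree (reverse (l ∷ gs)) (length gs) × coeff (reverse (l ∷ gs)) (length gs) ≡ l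
reverse-∷-HasDegree l gs l≢0 =
  HasDegree-resp (≋-sym (reverse-∷ l gs)) (top≢0 , above) , trans (get (reverse-∷ l gs) (length gs)) top
  where
  gs<gs : DegBelow (reverse gs) (length gs)
  gs<gs = subst (DegBelow (reverse gs)) (LP.length-reverse gs) (DegBelow-length (reverse gs))
  top : coeff (reverse gs +ₚ monomial l (length gs)) (length gs) ≡ l
  top = trans (coeff-+ (reverse gs) (monomial l (length gs)) (length gs))
        (trans (cong₂ _+_ (gs<gs (length gs) ℕP.≤-refl) (coeff-monomial l (length gs))) (ℚP.+-identityˡ l))
  top≢0 : coeff (reverse gs +ₚ monomial l (length gs)) (length gs) ≢ 0ℚ
  top≢0 z = l≢0 (trans (sym top) z)
  above : DegAtMost (reverse gs +ₚ monomial l (length gs)) (length gs)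
  above n lt = trans (coeff-+ (reverse gs) (monomial l (length gs)) n)
    (trans (cong₂ _+_ (gs<gs n (ℕP.<⇒≤ lt)) (monomial-DegAtMost l (length gs) n lt)) (ℚP.+-identityˡ 0ℚ))

-- The remainder of f modulo g is a multiple of g of smaller degree, hence zero.
quotMonic-correct′ : ∀ f g gs → divisorTail (reverse g) ≡ gs → g ≋ reverse (1ℚ ∷ gs) → g ∣ f →
                     f ≋ quotMonic f g *ₚ g
quotMonic-correct′ f g gs tail≡ g≋ g∣f = begin
  f              ≈⟨ f≋ ⟩
  Q *ₚ G +ₚ R    ≈⟨ +-cong (≋-refl {Q *ₚ G}) (mk R≡0) ⟩
  Q *ₚ G +ₚ []   ≈⟨ +-identityʳ (Q *ₚ G) ⟩
  Q *ₚ G         ≈⟨ *-cong (≡⇒≋ (sym quot≡)) (≋-sym g≋) ⟩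
  quotMonic f g *ₚ g ∎
  where
  open ≋-Reasoning
  Q = revDivH (length f) (reverse f) gs []
  G = reverse (1ℚ ∷ gs)
  quot≡ : quotMonic f g ≡ Q
  quot≡ = trans (quotMonic-unfold f g) (cong (λ gs → revDivH (length f) (reverse f) gs []) tail≡)
  division = revDivH-correct (length f) (reverse f) gs (ℕP.≤-reflexive (LP.length-reverse f))
  R = proj₁ division
  f≋ : f ≋ Q *ₚ G +ₚ R
  f≋ = ≋-trans (≡⇒≋ (sym (LP.reverse-involutive f))) (proj₁ (proj₂ division))
  g∣R : g ∣ R
  g∣R = ∣-resp (≋-trans (+-cong (≋-trans f≋ (+-cong (*-cong (≋-refl {Q}) (≋-sym g≋)) ≋-refl)) ≋-refl) (cancel (Q *ₚ g) R))
               (∣-- g∣f (∣-*ˡ Q (∣-refl {g})))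
    where
    cancel : ∀ a b → (a +ₚ b) -ₚ a ≋ b
    cancel = solve-∀ ℚ[x]-ring
  g-degree : HasDegree g (length gs)
  g-degree = HasDegree-resp (≋-sym g≋) (proj₁ (reverse-∷-HasDegree 1ℚ gs ℚP.1≢0))
  R≡0 : IsZeroPoly R
  R≡0 = IsZeroPoly-resp (equation g∣R) (get (≋-trans (*-cong (≋-refl {g}) (mk quotient≡0)) (*-zeroʳ g)))
    where
    quotient≡0 = DegBelow-multiple g (length gs) (quotient g∣R) g-degree
                   (λ n le → trans (get (equation g∣R) n) (proj₂ (proj₂ division) n le))

reverse-IsZeroPoly : ∀ xs → IsZeroPoly xs → IsZeroPoly (reverse xs)
reverse-IsZeroPoly []       z = z
reverse-IsZeroPoly (x ∷ xs) z = IsZeroPoly-resp (≋-sym (reverse-∷ x xs)) λ n →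
  trans (coeff-+ (reverse xs) (monomial x (length xs)) n)
        (trans (cong₂ _+_ (reverse-IsZeroPoly xs (z ∘ suc) n) (monomial≡0 (length xs) n)) (ℚP.+-identityˡ 0ℚ))
  where
  monomial≡0 : ∀ j n → coeff (monomial x j) n ≡ 0ℚ
  monomial≡0 zero    zero    = z 0
  monomial≡0 zero    (suc n) = refl
  monomial≡0 (suc j) zero    = refl
  monomial≡0 (suc j) (suc n) = monomial≡0 j n

divisorTail-zeros : ∀ zs l gs → IsZeroPoly zs → l ≢ 0ℚ → divisorTail (zs ++ l ∷ gs) ≡ gs
divisorTail-zeros []       l gs z l≢0 = divisorTail-∷ l gs l≢0
divisorTail-zeros (x ∷ zs) l gs z l≢0 =
  trans (divisorTail-0∷ x (zs ++ l ∷ gs) (z 0)) (divisorTail-zeros zs l gs (z ∘ suc) l≢0)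

record LeadingSplit (g : Poly) : Set where
  field
    zeros   : List ℚ
    lead    : ℚ
    rest    : List ℚ
    split   : reverse g ≡ zeros ++ lead ∷ rest
    zeros≡0 : IsZeroPoly zeros
    lead≢0  : lead ≢ 0ℚ
    g≋      : g ≋ reverse (lead ∷ rest)

leadingSplit : ∀ g → ¬ IsZeroPoly g → LeadingSplit g
leadingSplit []      g≢0 = ⊥-elim (g≢0 λ _ → refl)
leadingSplit (a ∷ g) g≢0 with IsZeroPoly? g
... | yes g≡0 = record
  { zeros = reverse g ; lead = a ; rest = [] ; split = LP.unfold-reverse a g ; zeros≡0 = reverse-IsZeroPoly g g≡0
  ; lead≢0 = λ a≡0 → g≢0 λ { zero → a≡0 ; (suc n) → g≡0 n }
  ; g≋ = mk λ { zero → refl ; (suc n) → g≡0 n } }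
... | no  g≢0′ = record
  { zeros = zeros ; lead = lead ; rest = rest ++ a ∷ [] ; zeros≡0 = zeros≡0 ; lead≢0 = lead≢0
  ; split = trans (LP.unfold-reverse a g) (trans (cong (_++ a ∷ []) split) (LP.++-assoc zeros (lead ∷ rest) (a ∷ [])))
  ; g≋ = ≋-trans (∷-cong a g≋) (≡⇒≋ (sym reverse-lead)) }
  where
  open LeadingSplit (leadingSplit g g≢0′)
  reverse-lead : reverse (lead ∷ rest ++ a ∷ []) ≡ a ∷ reverse (lead ∷ rest)
  reverse-lead = begin
    reverse (lead ∷ rest ++ a ∷ [])     ≡⟨ LP.unfold-reverse lead (rest ++ a ∷ []) ⟩
    reverse (rest ++ a ∷ []) ++ lead ∷ [] ≡⟨ cong (_++ lead ∷ []) (LP.reverse-++ rest (a ∷ [])) ⟩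
    a ∷ reverse rest ++ lead ∷ []       ≡⟨ cong (a ∷_) (LP.unfold-reverse lead rest) ⟨
    a ∷ reverse (lead ∷ rest)           ∎
    where open ≡-Reasoning

Monic : Poly → ℕ → Set
Monic p d = HasDegree p d × coeff p d ≡ 1ℚ

Monic-divisorTail : ∀ g d → Monic g d → ∃[ gs ] (divisorTail (reverse g) ≡ gs × g ≋ reverse (1ℚ ∷ gs))
Monic-divisorTail g d (g-degree , top≡1) = rest , tail≡ , subst (λ l → g ≋ reverse (l ∷ rest)) lead≡1 g≋
  where
  open LeadingSplit (leadingSplit g λ g≡0 → proj₁ g-degree (g≡0 d))
  tail≡ : divisorTail (reverse g) ≡ rest
  tail≡ = trans (cong divisorTail split) (divisorTail-zeros zeros lead rest zeros≡0 lead≢0)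
  lead-degree = reverse-∷-HasDegree lead rest lead≢0
  d≡ : d ≡ length rest
  d≡ = HasDegree-unique g d (length rest) g-degree (HasDegree-resp (≋-sym g≋) (proj₁ lead-degree))
  lead≡1 : lead ≡ 1ℚ
  lead≡1 = trans (sym (proj₂ lead-degree)) (trans (sym (get g≋ (length rest))) (trans (cong (coeff g) (sym d≡)) top≡1))

quotMonic-correct : ∀ f g d → Monic g d → g ∣ f → f ≋ quotMonic f g *ₚ g
quotMonic-correct f g d g-monic g∣f =
  let (gs , tail≡ , g≋) = Monic-divisorTail g d g-monic in quotMonic-correct′ f g gs tail≡ g≋ g∣f

Monic-* : ∀ p q a b → Monic p a → Monic q b → Monic (p *ₚ q) (a ℕ.+ b)
Monic-* p q a b (pa , p-top) (qb , q-top) =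
  HasDegree-* p q a b pa qb ,
  trans (proj₂ (*-DegAtMost p q a b (proj₂ pa) (proj₂ qb))) (trans (cong₂ _*_ p-top q-top) (ℚP.*-identityˡ 1ℚ))

Monic-quotient : ∀ f g Q a b → Monic f a → Monic g b → f ≋ Q *ₚ g → ∃[ c ] Monic Q c
Monic-quotient f g Q a b (fa , f-top) (gb , g-top) f≋Qg with IsZeroPoly? Q
... | yes Q≡0 = ⊥-elim (proj₁ fa (IsZeroPoly-resp (≋-sym f≋Qg) (get (*-cong {Q} {[]} {g} {g} (mk Q≡0) ≋-refl)) a))
... | no  Q≢0 = c , Qc , Q-top
  where
  c = proj₁ (degree Q Q≢0)
  Qc = proj₂ (degree Q Q≢0)
  c+b≡a : c ℕ.+ b ≡ a
  c+b≡a = HasDegree-unique f (c ℕ.+ b) a (HasDegree-resp (≋-sym f≋Qg) (HasDegree-* Q g c b Qc gb)) fa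
  Q-top : coeff Q c ≡ 1ℚ
  Q-top = begin
    coeff Q c                 ≡⟨ ℚP.*-identityʳ (coeff Q c) ⟨
    coeff Q c * 1ℚ            ≡⟨ cong (coeff Q c *_) g-top ⟨
    coeff Q c * coeff g b     ≡⟨ proj₂ (*-DegAtMost Q g c b (proj₂ Qc) (proj₂ gb)) ⟨
    coeff (Q *ₚ g) (c ℕ.+ b)  ≡⟨ get f≋Qg (c ℕ.+ b) ⟨
    coeff f (c ℕ.+ b)         ≡⟨ cong (coeff f) c+b≡a ⟩
    coeff f a                 ≡⟨ f-top ⟩
    1ℚ                        ∎
    where open ≡-Reasoning

-- Cyclotomic polynomials

1ₚ : Poly
1ₚ = const 1ℚ

^-+ : ∀ p a b → p ^ₚ (a ℕ.+ b) ≋ p ^ₚ a *ₚ p ^ₚ b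
^-+ p zero    b = ≋-sym (*-identityˡ (p ^ₚ b))
^-+ p (suc a) b = ≋-trans (*-cong (≋-refl {p}) (^-+ p a b)) (≋-sym (*-assoc p (p ^ₚ a) (p ^ₚ b)))

X^≋monomial : ∀ n → X ^ₚ n ≋ monomial 1ℚ n
X^≋monomial zero    = ≋-refl
X^≋monomial (suc n) = ≋-trans (*-cong (≋-refl {X}) (X^≋monomial n))
  (≋-trans (monomial-*-monomial 1ℚ 1 1ℚ n) (≡⇒≋ (cong (λ c → monomial c (suc n)) (ℚP.*-identityˡ 1ℚ))))

Monic-xk-1 : ∀ n → 1 ≤ n → Monic (xk-1 n) n
Monic-xk-1 (suc n) _ = (top≢0 , above) , top
  where
  xⁿ-1≋ : xk-1 (suc n) ≋ monomial 1ℚ (suc n) -ₚ 1ₚ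
  xⁿ-1≋ = +-cong (X^≋monomial (suc n)) ≋-refl
  top : coeff (xk-1 (suc n)) (suc n) ≡ 1ℚ
  top = trans (get xⁿ-1≋ (suc n)) (trans (coeff-- (monomial 1ℚ (suc n)) 1ₚ (suc n))
        (trans (cong (_- 0ℚ) (coeff-monomial 1ℚ (suc n))) (ℚP.+-identityʳ 1ℚ)))
  top≢0 : coeff (xk-1 (suc n)) (suc n) ≢ 0ℚ
  top≢0 z = ℚP.1≢0 (trans (sym top) z)
  1ₚ-above : ∀ m → suc n < m → coeff 1ₚ m ≡ 0ℚ
  1ₚ-above (suc m) _ = refl
  above : DegAtMost (xk-1 (suc n)) (suc n)
  above m lt = trans (get xⁿ-1≋ m) (trans (coeff-- (monomial 1ℚ (suc n)) 1ₚ m)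
    (trans (cong₂ _-_ (monomial-DegAtMost 1ℚ (suc n) m lt) (1ₚ-above m lt)) (ℚP.+-inverseʳ 0ℚ)))

xk-1-nonZero : ∀ n → 1 ≤ n → ¬ IsZeroPoly (xk-1 n)
xk-1-nonZero n 1≤n z = proj₁ (proj₁ (Monic-xk-1 n 1≤n)) (z n)

geometric : ℕ → ℕ → Poly
geometric a zero    = []
geometric a (suc m) = 1ₚ +ₚ X ^ₚ a *ₚ geometric a m

xk-1-*-geometric : ∀ a m → xk-1 a *ₚ geometric a m ≋ xk-1 (a ℕ.* m)
xk-1-*-geometric a zero = ≋-trans (*-zeroʳ (xk-1 a))
  (≋-sym (≋-trans (≡⇒≋ (cong xk-1 (ℕP.*-zeroʳ a))) (+-inverseʳ 1ₚ)))
xk-1-*-geometric a (suc m) = begin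
  xk-1 a *ₚ (1ₚ +ₚ X ^ₚ a *ₚ geometric a m)            ≈⟨ distrib (X ^ₚ a) (geometric a m) ⟩
  xk-1 a +ₚ X ^ₚ a *ₚ (xk-1 a *ₚ geometric a m)
    ≈⟨ +-cong (≋-refl {xk-1 a}) (*-cong (≋-refl {X ^ₚ a}) (xk-1-*-geometric a m)) ⟩
  xk-1 a +ₚ X ^ₚ a *ₚ xk-1 (a ℕ.* m)                  ≈⟨ telescope (X ^ₚ a) (X ^ₚ (a ℕ.* m)) ⟩
  X ^ₚ a *ₚ X ^ₚ (a ℕ.* m) -ₚ 1ₚ                      ≈⟨ +-cong (^-+ X a (a ℕ.* m)) (≋-refl {negₚ 1ₚ}) ⟨
  X ^ₚ (a ℕ.+ a ℕ.* m) -ₚ 1ₚ                          ≡⟨ cong xk-1 (ℕP.*-suc a m) ⟨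
  xk-1 (a ℕ.* suc m)                                  ∎
  where
  open ≋-Reasoning
  distrib : ∀ Y G → (Y -ₚ 1ₚ) *ₚ (1ₚ +ₚ Y *ₚ G) ≋ (Y -ₚ 1ₚ) +ₚ Y *ₚ ((Y -ₚ 1ₚ) *ₚ G)
  distrib = solve-∀ ℚ[x]-ring
  telescope : ∀ Y Z → (Y -ₚ 1ₚ) +ₚ Y *ₚ (Z -ₚ 1ₚ) ≋ Y *ₚ Z -ₚ 1ₚ
  telescope = solve-∀ ℚ[x]-ring

xk-1-∣ : ∀ a m → xk-1 a ∣ xk-1 (a ℕ.* m)
xk-1-∣ a m = divides (geometric a m) (xk-1-*-geometric a m)

toℚ : ℕ → ℚ
toℚ zero    = 0ℚ
toℚ (suc m) = 1ℚ + toℚ m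

toℚ-nonZero : ∀ m → 1 ≤ m → toℚ m ≢ 0ℚ
toℚ-nonZero (suc m) _ m+1≡0 = ℚP.<-irrefl (sym m+1≡0) (ℚP.positive⁻¹ (toℚ (suc m)) {{positive m}})
  where
  nonNeg : ∀ m → ℚ.NonNegative (toℚ m)
  positive : ∀ m → ℚ.Positive (toℚ (suc m))
  nonNeg zero    = _
  nonNeg (suc m) = ℚP.pos⇒nonNeg (toℚ (suc m)) {{positive m}}
  positive m = ℚP.pos+nonNeg⇒pos 1ℚ (toℚ m) {{nonNeg m}}

-- Since x^a ≡ 1, the m-term geometric sum is ≡ m modulo x^a - 1.
geometric-mod : ∀ a m → xk-1 a ∣ geometric a m -ₚ const (toℚ m)
geometric-mod a zero    = ∣-zero (mk λ { zero → ℚP.+-inverseʳ 0ℚ ; (suc n) → refl })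
geometric-mod a (suc m) = ∣-resp (≋-sym (split (X ^ₚ a) (geometric a m) (const (toℚ m))))
                                  (∣-+ (∣-*ʳ (geometric a m) ∣-refl) (geometric-mod a m))
  where
  split : ∀ Y G N → (1ₚ +ₚ Y *ₚ G) -ₚ (1ₚ +ₚ N) ≋ (Y -ₚ 1ₚ) *ₚ G +ₚ (G -ₚ N)
  split = solve-∀ ℚ[x]-ring

Coprime : Poly → Poly → Set
Coprime A B = ∃[ u ] ∃[ v ] (u *ₚ A +ₚ v *ₚ B ≋ 1ₚ)

Coprime-sym : ∀ {A B} → Coprime A B → Coprime B A
Coprime-sym {A} {B} (u , v , e) = v , u , ≋-trans (+-comm (v *ₚ B) (u *ₚ A)) e

Coprime-∣ˡ : ∀ {A A′ B} → A ∣ A′ → Coprime A′ B → Coprime A B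
Coprime-∣ˡ {A} {A′} {B} (divides w A*w≋A′) (u , v , e) =
  u *ₚ w , v , ≋-trans (+-cong (≋-trans (*-assoc u w A) (*-cong (≋-refl {u}) (≋-trans (*-comm w A) A*w≋A′))) ≋-refl) e

Coprime-*ʳ : ∀ {A B C} → Coprime A B → Coprime A C → Coprime A (B *ₚ C)
Coprime-*ʳ {A} {B} {C} (u , v , e) (u′ , v′ , e′) =
  u *ₚ (u′ *ₚ A +ₚ v′ *ₚ C) +ₚ (v *ₚ B) *ₚ u′ , v *ₚ v′ ,
  ≋-trans (expand u v u′ v′ A B C) (≋-trans (*-cong e e′) (*-identityˡ 1ₚ))
  where
  expand : ∀ u v u′ v′ A B C →
           (u *ₚ (u′ *ₚ A +ₚ v′ *ₚ C) +ₚ (v *ₚ B) *ₚ u′) *ₚ A +ₚ (v *ₚ v′) *ₚ (B *ₚ C) ≋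
           (u *ₚ A +ₚ v *ₚ B) *ₚ (u′ *ₚ A +ₚ v′ *ₚ C)
  expand = solve-∀ ℚ[x]-ring

Coprime-1ₚ : ∀ {A} → Coprime A 1ₚ
Coprime-1ₚ = [] , 1ₚ , *-identityˡ 1ₚ

Coprime⇒*∣ : ∀ {A B N} → Coprime A B → A ∣ N → B ∣ N → A *ₚ B ∣ N
Coprime⇒*∣ {A} {B} {N} (u , v , e) (divides x A*x≋N) (divides y B*y≋N) = divides (u *ₚ y +ₚ v *ₚ x) (begin
  (A *ₚ B) *ₚ (u *ₚ y +ₚ v *ₚ x)          ≈⟨ expand A B u v x y ⟩
  (u *ₚ A) *ₚ (B *ₚ y) +ₚ (v *ₚ B) *ₚ (A *ₚ x) ≈⟨ +-cong (*-cong (≋-refl {u *ₚ A}) B*y≋N) (*-cong (≋-refl {v *ₚ B}) A*x≋N) ⟩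
  (u *ₚ A) *ₚ N +ₚ (v *ₚ B) *ₚ N          ≈⟨ *-distribʳ-+ N (u *ₚ A) (v *ₚ B) ⟨
  (u *ₚ A +ₚ v *ₚ B) *ₚ N                 ≈⟨ *-cong e (≋-refl {N}) ⟩
  1ₚ *ₚ N                                 ≈⟨ *-identityˡ N ⟩
  N                                       ∎)
  where
  open ≋-Reasoning
  expand : ∀ A B u v x y → (A *ₚ B) *ₚ (u *ₚ y +ₚ v *ₚ x) ≋ (u *ₚ A) *ₚ (B *ₚ y) +ₚ (v *ₚ B) *ₚ (A *ₚ x)
  expand = solve-∀ ℚ[x]-ring

eval-+ : ∀ p q a → eval (p +ₚ q) a ≡ eval p a + eval q a
eval-+ []      q       a = sym (ℚP.+-identityˡ _)
eval-+ (x ∷ p) []      a = sym (ℚP.+-identityʳ _)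
eval-+ (x ∷ p) (y ∷ q) a = trans (cong (λ z → (x + y) + a * z) (eval-+ p q a)) (regroup x y a (eval p a) (eval q a))
  where
  regroup : ∀ x y a P Q → (x + y) + a * (P + Q) ≡ (x + a * P) + (y + a * Q)
  regroup = solve-∀ ℚ-ring

eval-· : ∀ c p a → eval (c ·ₚ p) a ≡ c * eval p a
eval-· c []      a = sym (ℚP.*-zeroʳ c)
eval-· c (x ∷ p) a = trans (cong (λ z → c * x + a * z) (eval-· c p a)) (regroup c x a (eval p a))
  where
  regroup : ∀ c x a P → c * x + a * (c * P) ≡ c * (x + a * P)
  regroup = solve-∀ ℚ-ring

eval-* : ∀ p q a → eval (p *ₚ q) a ≡ eval p a * eval q a
eval-* []      q a = sym (ℚP.*-zeroˡ (eval q a))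
eval-* (x ∷ p) q a = trans (eval-+ (x ·ₚ q) (0ℚ ∷ (p *ₚ q)) a)
  (trans (cong₂ (λ u w → u + (0ℚ + a * w)) (eval-· x q a) (eval-* p q a)) (regroup x a (eval p a) (eval q a)))
  where
  regroup : ∀ x a P Q → x * Q + (0ℚ + a * (P * Q)) ≡ (x + a * P) * Q
  regroup = solve-∀ ℚ-ring

eval-IsZeroPoly : ∀ p a → IsZeroPoly p → eval p a ≡ 0ℚ
eval-IsZeroPoly []      a z = refl
eval-IsZeroPoly (x ∷ p) a z = trans (cong₂ (λ u w → u + a * w) (z 0) (eval-IsZeroPoly p a (z ∘ suc)))
                                     (trans (cong (_+_ (0ℚ)) (ℚP.*-zeroʳ a)) (ℚP.+-identityˡ 0ℚ))

eval-neg : ∀ p a → eval (negₚ p) a ≡ - eval p a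
eval-neg []      a = refl
eval-neg (x ∷ p) a = trans (cong (λ z → - x + a * z) (eval-neg p a)) (regroup x a (eval p a))
  where
  regroup : ∀ x a P → - x + a * (- P) ≡ - (x + a * P)
  regroup = solve-∀ ℚ-ring

eval-resp : ∀ {p q} a → p ≋ q → eval p a ≡ eval q a
eval-resp {p} {q} a p≋q = begin
  eval p a                          ≡⟨ cancel (eval p a) (eval q a) ⟨
  (eval p a - eval q a) + eval q a  ≡⟨ cong (_+ eval q a) p-q≡0 ⟩
  0ℚ + eval q a                     ≡⟨ ℚP.+-identityˡ (eval q a) ⟩
  eval q a                          ∎
  where
  open ≡-Reasoning
  cancel : ∀ x y → (x - y) + y ≡ x
  cancel = solve-∀ ℚ-ring
  p-q≡0 : eval p a - eval q a ≡ 0ℚ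
  p-q≡0 = trans (sym (trans (eval-+ p (negₚ q) a) (cong (_+_ (eval p a)) (eval-neg q a))))
                (eval-IsZeroPoly (p -ₚ q) a (get (≋-trans (+-cong p≋q ≋-refl) (+-inverseʳ q))))

eval-geometric-1 : ∀ m → eval (geometric 1 m) 1ℚ ≡ toℚ m
eval-geometric-1 zero    = refl
eval-geometric-1 (suc m) = trans (eval-+ 1ₚ (X ^ₚ 1 *ₚ geometric 1 m) 1ℚ)
  (cong (_+_ (1ℚ)) (trans (eval-* (X ^ₚ 1) (geometric 1 m) 1ℚ)
  (trans (cong (eval (X ^ₚ 1) 1ℚ *_) (eval-geometric-1 m)) (ℚP.*-identityˡ (toℚ m)))))

filter-filter-⊆ : ∀ {P Q : Pred ℕ 0ℓ} (P? : Decidable P) (Q? : Decidable Q) → (∀ {x} → P x → Q x) →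
                  ∀ xs → filter P? (filter Q? xs) ≡ filter P? xs
filter-filter-⊆ P? Q? P⊆Q [] = refl
filter-filter-⊆ P? Q? P⊆Q (x ∷ xs) with ih ← filter-filter-⊆ P? Q? P⊆Q xs | Q? x
... | no ¬qx = trans ih (sym (LP.filter-reject P? (¬qx ∘ P⊆Q)))
... | yes _ with does (P? x)
...   | true  = cong (x ∷_) ih
...   | false = ih

applyUpTo-++ : ∀ (f : ℕ → ℕ) m n → applyUpTo f (m ℕ.+ n) ≡ applyUpTo f m ++ applyUpTo (λ i → f (m ℕ.+ i)) n
applyUpTo-++ f zero    n = refl
applyUpTo-++ f (suc m) n = cong (f 0 ∷_) (applyUpTo-++ (f ∘ suc) m n)

properDivisors-properties : ∀ k → All (λ d → d ∣ℕ k × 1 ≤ d × d < k) (properDivisors k)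
properDivisors-properties zero    = []
properDivisors-properties (suc n) =
  All.zip (AllP.all-filter (_∣? suc n) (applyUpTo suc n) ,
           AllP.filter⁺ (_∣? suc n) (AllP.applyUpTo⁺₁ {P = λ d → 1 ≤ d × d < suc n} suc n (λ i<n → s≤s z≤n , s≤s i<n)))

properDivisors-increasing : ∀ k → AllPairs _<_ (properDivisors k)
properDivisors-increasing zero    = []
properDivisors-increasing (suc n) =
  AllPairsP.filter⁺ (_∣? suc n) (AllPairsP.applyUpTo⁺₁ suc n (λ i<j _ → s≤s i<j))

properDivisors-filter : ∀ c d → c ∣ℕ d → 1 ≤ c → c < d →
                        filter (_∣? c) (properDivisors d) ≡ properDivisors c ++ (c ∷ [])
properDivisors-filter (suc c′) (suc d′) c∣d _ (s≤s c<d) = begin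
  filter (_∣? c) (filter (_∣? d) (applyUpTo suc d′))
    ≡⟨ filter-filter-⊆ (_∣? c) (_∣? d) (λ x∣c → ℕD.∣-trans x∣c c∣d) (applyUpTo suc d′) ⟩
  filter (_∣? c) (applyUpTo suc d′)
    ≡⟨ cong (filter (_∣? c)) (trans (cong (applyUpTo suc) (sym (ℕP.m+[n∸m]≡n c<d))) (applyUpTo-++ suc c (d′ ∸ c))) ⟩
  filter (_∣? c) (applyUpTo suc c ++ beyond)
    ≡⟨ LP.filter-++ (_∣? c) (applyUpTo suc c) beyond ⟩
  filter (_∣? c) (applyUpTo suc c) ++ filter (_∣? c) beyond
    ≡⟨ cong₂ _++_ (cong (filter (_∣? c)) (sym (LP.applyUpTo-∷ʳ suc c′))) (LP.filter-none (_∣? c) none-beyond) ⟩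
  filter (_∣? c) (applyUpTo suc c′ ++ (c ∷ [])) ++ []
    ≡⟨ LP.++-identityʳ _ ⟩
  filter (_∣? c) (applyUpTo suc c′ ++ (c ∷ []))
    ≡⟨ LP.filter-++ (_∣? c) (applyUpTo suc c′) (c ∷ []) ⟩
  filter (_∣? c) (applyUpTo suc c′) ++ filter (_∣? c) (c ∷ [])
    ≡⟨ cong (filter (_∣? c) (applyUpTo suc c′) ++_) (LP.filter-accept (_∣? c) ℕD.∣-refl) ⟩
  properDivisors c ++ (c ∷ [])
    ∎
  where
  open ≡-Reasoning
  c = suc c′
  d = suc d′
  beyond = applyUpTo (λ i → suc (c ℕ.+ i)) (d′ ∸ c)
  none-beyond : All (λ x → ¬ (x ∣ℕ c)) beyond
  none-beyond = AllP.applyUpTo⁺₂ _ (d′ ∸ c) λ i x∣c →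
    ℕP.<-irrefl refl (ℕP.≤-trans (s≤s (ℕP.m≤m+n c i)) (∣⇒≤ x∣c))

∏Φ : List ℕ → Poly
∏Φ = foldr (λ d acc → Φ d *ₚ acc) 1ₚ

∏Φ-++ : ∀ xs ys → ∏Φ (xs ++ ys) ≋ ∏Φ xs *ₚ ∏Φ ys
∏Φ-++ []       ys = ≋-sym (*-identityˡ (∏Φ ys))
∏Φ-++ (x ∷ xs) ys = ≋-trans (*-cong (≋-refl {Φ x}) (∏Φ-++ xs ys)) (≋-sym (*-assoc (Φ x) (∏Φ xs) (∏Φ ys)))

∏Φ-filter-∣ : ∀ {P : ℕ → Set} (P? : Decidable P) xs → ∏Φ (filter P? xs) ∣ ∏Φ xs
∏Φ-filter-∣ P? []       = ∣-refl
∏Φ-filter-∣ P? (x ∷ xs) with P? x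
... | yes _ = let divides w e = ∏Φ-filter-∣ P? xs
              in divides w (≋-trans (*-assoc (Φ x) _ w) (*-cong (≋-refl {Φ x}) e))
... | no  _ = ∣-*ˡ (Φ x) (∏Φ-filter-∣ P? xs)

foldr-cycF-factor : ∀ f L → All (λ d → cycF f d ≡ Φ d) L → foldr (cycF-factor f) 1ₚ L ≡ ∏Φ L
foldr-cycF-factor f []      []       = refl
foldr-cycF-factor f (d ∷ L) (e ∷ es) =
  trans (cycF-factor-≡ f d (foldr (cycF-factor f) 1ₚ L)) (cong₂ _*ₚ_ e (foldr-cycF-factor f L es))

cycF-stable : ∀ e → 1 ≤ e → ∀ f → e ≤ f → cycF f e ≡ Φ e
cycF-stable = <-rec (λ e → 1 ≤ e → ∀ f → e ≤ f → cycF f e ≡ Φ e) step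
  where
  step : ∀ e → (∀ {y} → y < e → 1 ≤ y → ∀ f → y ≤ f → cycF f y ≡ Φ y) →
         1 ≤ e → ∀ f → e ≤ f → cycF f e ≡ Φ e
  step (suc e) rec _ (suc f) (s≤s e≤f) =
    cong (quotMonic (xk-1 (suc e))) (trans (foldr-cycF-factor f _ (stable f e≤f))
                                            (sym (foldr-cycF-factor e _ (stable e ℕP.≤-refl))))
    where
    stable : ∀ g → e ≤ g → All (λ d → cycF g d ≡ Φ d) (properDivisors (suc e))
    stable g e≤g = All.map (λ { (_ , 1≤d , s≤s d≤e) → rec (s≤s d≤e) 1≤d g (ℕP.≤-trans d≤e e≤g) })
                           (properDivisors-properties (suc e))

Φ-unfold : ∀ n → Φ (suc n) ≡ quotMonic (xk-1 (suc n)) (∏Φ (properDivisors (suc n)))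
Φ-unfold n = cong (quotMonic (xk-1 (suc n))) (foldr-cycF-factor n (properDivisors (suc n))
  (All.map (λ { (_ , 1≤d , s≤s d≤n) → cycF-stable _ 1≤d n d≤n }) (properDivisors-properties (suc n))))

CyclotomicIdentity : ℕ → Set
CyclotomicIdentity k = Φ k *ₚ ∏Φ (properDivisors k) ≋ xk-1 k

xk-1-∣-∏Φ-properDivisors : ∀ c d → CyclotomicIdentity c → c ∣ℕ d → 1 ≤ c → c < d →
                           xk-1 c ∣ ∏Φ (properDivisors d)
xk-1-∣-∏Φ-properDivisors c d Φc c∣d 1≤c c<d = ∣-trans (divides 1ₚ ∏≋) (∏Φ-filter-∣ (_∣? c) (properDivisors d))
  where
  ∏≋ : xk-1 c *ₚ 1ₚ ≋ ∏Φ (filter (_∣? c) (properDivisors d))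
  ∏≋ = ≋-sym (begin
    ∏Φ (filter (_∣? c) (properDivisors d))    ≡⟨ cong ∏Φ (properDivisors-filter c d c∣d 1≤c c<d) ⟩
    ∏Φ (properDivisors c ++ (c ∷ []))          ≈⟨ ∏Φ-++ (properDivisors c) (c ∷ []) ⟩
    ∏Φ (properDivisors c) *ₚ (Φ c *ₚ 1ₚ)        ≈⟨ *-cong (≋-refl {∏Φ (properDivisors c)}) (*-identityʳ (Φ c)) ⟩
    ∏Φ (properDivisors c) *ₚ Φ c               ≈⟨ *-comm (∏Φ (properDivisors c)) (Φ c) ⟩
    Φ c *ₚ ∏Φ (properDivisors c)               ≈⟨ Φc ⟩
    xk-1 c                                     ≈⟨ *-identityʳ (xk-1 c) ⟨
    xk-1 c *ₚ 1ₚ                               ∎)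
    where open ≋-Reasoning

Φ-∣-geometric : ∀ c d m → CyclotomicIdentity c → CyclotomicIdentity d → d ≡ c ℕ.* m → 1 ≤ c → c < d →
                Φ d ∣ geometric c m
Φ-∣-geometric c d m Φc Φd d≡cm 1≤c c<d =
  divides P (*-cancelʳ (Φ d *ₚ P) (geometric c m) (xk-1 c) (xk-1-nonZero c 1≤c) (begin
    (Φ d *ₚ P) *ₚ xk-1 c        ≈⟨ *-assoc (Φ d) P (xk-1 c) ⟩
    Φ d *ₚ (P *ₚ xk-1 c)        ≈⟨ *-cong (≋-refl {Φ d}) (≋-trans (*-comm P (xk-1 c)) (equation xc∣∏)) ⟩
    Φ d *ₚ ∏Φ (properDivisors d) ≈⟨ Φd ⟩
    xk-1 d                      ≡⟨ cong xk-1 d≡cm ⟩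
    xk-1 (c ℕ.* m)              ≈⟨ xk-1-*-geometric c m ⟨
    xk-1 c *ₚ geometric c m      ≈⟨ *-comm (xk-1 c) (geometric c m) ⟩
    geometric c m *ₚ xk-1 c      ∎))
  where
  open ≋-Reasoning
  xc∣∏ = xk-1-∣-∏Φ-properDivisors c d Φc (ℕD.divides m (trans d≡cm (ℕP.*-comm c m))) 1≤c c<d
  P = quotient xc∣∏

-- From c + y b = x a: x^(xa) - 1 = (x^c - 1) + x^c (x^(yb) - 1).
xk-1-combination : ∀ c a b x y → c ℕ.+ y ℕ.* b ≡ x ℕ.* a →
                   xk-1 c ≋ geometric a x *ₚ xk-1 a +ₚ negₚ (X ^ₚ c *ₚ geometric b y) *ₚ xk-1 b
xk-1-combination c a b x y c+yb≡xa = ≋-sym (begin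
  geometric a x *ₚ xk-1 a +ₚ negₚ (X ^ₚ c *ₚ geometric b y) *ₚ xk-1 b
    ≈⟨ regroup (geometric a x) (xk-1 a) (X ^ₚ c) (geometric b y) (xk-1 b) ⟩
  xk-1 a *ₚ geometric a x -ₚ X ^ₚ c *ₚ (xk-1 b *ₚ geometric b y)
    ≈⟨ +-cong (xk-1-*-geometric a x) (neg-cong (*-cong (≋-refl {X ^ₚ c}) (xk-1-*-geometric b y))) ⟩
  xk-1 (a ℕ.* x) -ₚ X ^ₚ c *ₚ xk-1 (b ℕ.* y)
    ≡⟨ cong (λ n → xk-1 n -ₚ X ^ₚ c *ₚ xk-1 (b ℕ.* y)) exponent ⟩
  (X ^ₚ (c ℕ.+ b ℕ.* y) -ₚ 1ₚ) -ₚ X ^ₚ c *ₚ xk-1 (b ℕ.* y)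
    ≈⟨ +-cong (+-cong (^-+ X c (b ℕ.* y)) (≋-refl {negₚ 1ₚ})) (≋-refl {negₚ (X ^ₚ c *ₚ xk-1 (b ℕ.* y))}) ⟩
  (X ^ₚ c *ₚ X ^ₚ (b ℕ.* y) -ₚ 1ₚ) -ₚ X ^ₚ c *ₚ (X ^ₚ (b ℕ.* y) -ₚ 1ₚ)
    ≈⟨ telescope (X ^ₚ c) (X ^ₚ (b ℕ.* y)) ⟩
  xk-1 c ∎)
  where
  open ≋-Reasoning
  exponent : a ℕ.* x ≡ c ℕ.+ b ℕ.* y
  exponent = trans (ℕP.*-comm a x) (trans (sym c+yb≡xa) (cong (c ℕ.+_) (ℕP.*-comm y b)))
  regroup : ∀ Ga Ea Y Gb Eb → Ga *ₚ Ea +ₚ negₚ (Y *ₚ Gb) *ₚ Eb ≋ Ea *ₚ Ga -ₚ Y *ₚ (Eb *ₚ Gb)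
  regroup = solve-∀ ℚ[x]-ring
  telescope : ∀ Y Z → (Y *ₚ Z -ₚ 1ₚ) -ₚ Y *ₚ (Z -ₚ 1ₚ) ≋ Y -ₚ 1ₚ
  telescope = solve-∀ ℚ[x]-ring

xk-1-gcd-combination : ∀ c d e → Bézout.Identity c d e → ∃[ α ] ∃[ β ] (xk-1 c ≋ α *ₚ xk-1 d +ₚ β *ₚ xk-1 e)
xk-1-gcd-combination c d e (Bézout.+- x y eq) =
  geometric d x , negₚ (X ^ₚ c *ₚ geometric e y) , xk-1-combination c d e x y eq
xk-1-gcd-combination c d e (Bézout.-+ x y eq) =
  negₚ (X ^ₚ c *ₚ geometric d x) , geometric e y ,
  ≋-trans (xk-1-combination c e d y x eq) (+-comm (geometric e y *ₚ xk-1 e) (negₚ (X ^ₚ c *ₚ geometric d x) *ₚ xk-1 d))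

-- geometric c m ≡ m, a unit, modulo x^c - 1, and x^c - 1 lies in the ideal generated by
-- x^(cm) - 1 = (x^c - 1) · geometric c m and x^e - 1.
Coprime-geometric-xk-1 : ∀ c m e α β → 1 ≤ m → xk-1 c ≋ α *ₚ xk-1 (c ℕ.* m) +ₚ β *ₚ xk-1 e →
                         Coprime (geometric c m) (xk-1 e)
Coprime-geometric-xk-1 c m e α β 1≤m comb = u , v , (begin
  u *ₚ G +ₚ v *ₚ xk-1 e
    ≈⟨ expand μ⁻¹ G H α β (xk-1 c) (xk-1 e) ⟩
  μ⁻¹ *ₚ (G -ₚ H *ₚ (α *ₚ (xk-1 c *ₚ G) +ₚ β *ₚ xk-1 e))
    ≈⟨ *-cong (≋-refl {μ⁻¹}) (+-cong (≋-refl {G}) (neg-cong (*-cong (≋-refl {H}) (≋-sym comb′)))) ⟩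
  μ⁻¹ *ₚ (G -ₚ H *ₚ xk-1 c)
    ≈⟨ *-cong (≋-refl {μ⁻¹}) (≋-trans (+-cong (≋-refl {G}) (neg-cong (≋-trans (*-comm H (xk-1 c)) (equation G≡μ))))
                                       (cancel G (const μ))) ⟩
  μ⁻¹ *ₚ const μ
    ≈⟨ ≋-trans (const-* (ℚ.1/ μ) μ) (const-cong (ℚP.*-inverseˡ μ)) ⟩
  1ₚ ∎)
  where
  open ≋-Reasoning
  G = geometric c m
  μ = toℚ m
  instance _ = ℚ.≢-nonZero (toℚ-nonZero m 1≤m)
  μ⁻¹ = const (ℚ.1/ μ)
  G≡μ = geometric-mod c m
  H = quotient G≡μ
  u = μ⁻¹ *ₚ (1ₚ -ₚ H *ₚ α *ₚ xk-1 c)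
  v = negₚ (μ⁻¹ *ₚ H *ₚ β)
  comb′ : xk-1 c ≋ α *ₚ (xk-1 c *ₚ G) +ₚ β *ₚ xk-1 e
  comb′ = ≋-trans comb (+-cong (*-cong (≋-refl {α}) (≋-sym (xk-1-*-geometric c m))) ≋-refl)
  expand : ∀ i G H α β Ec Ee → (i *ₚ (1ₚ -ₚ H *ₚ α *ₚ Ec)) *ₚ G +ₚ negₚ (i *ₚ H *ₚ β) *ₚ Ee ≋
                              i *ₚ (G -ₚ H *ₚ (α *ₚ (Ec *ₚ G) +ₚ β *ₚ Ee))
  expand = solve-∀ ℚ[x]-ring
  cancel : ∀ G N → G -ₚ (G -ₚ N) ≋ N
  cancel = solve-∀ ℚ[x]-ring

∣-positive : ∀ {c d} → c ∣ℕ d → 1 ≤ d → 1 ≤ c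
∣-positive {zero}  c∣d 1≤d = ⊥-elim (ℕP.<-irrefl (sym (ℕD.0∣⇒≡0 c∣d)) 1≤d)
∣-positive {suc _} _   _   = s≤s z≤n

IdentitiesBelow : ℕ → Set
IdentitiesBelow K = ∀ j → 1 ≤ j → j < K → CyclotomicIdentity j

-- With d = c m: Φ d divides geometric c m, which is coprime to x^e - 1, a multiple of Φ e.
Φ-coprime-via-gcd : ∀ K c d e → IdentitiesBelow K → Bézout.Identity c d e → c ∣ℕ d →
                    1 ≤ c → c < d → d < K → 1 ≤ e → e < K → Coprime (Φ d) (Φ e)
Φ-coprime-via-gcd K c d e ids bez (ℕD.divides m d≡mc) 1≤c c<d d<K 1≤e e<K =
  Coprime-∣ˡ Φd∣G (Coprime-sym (Coprime-∣ˡ Φe∣xe-1 (Coprime-sym (Coprime-geometric-xk-1 c m e α β 1≤m comb))))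
  where
  d≡cm = trans d≡mc (ℕP.*-comm m c)
  1≤d = ℕP.≤-trans 1≤c (ℕP.<⇒≤ c<d)
  1≤m = ∣-positive (ℕD.divides c d≡cm) 1≤d
  Φd∣G = Φ-∣-geometric c d m (ids c 1≤c (ℕP.<-trans c<d d<K)) (ids d 1≤d d<K) d≡cm 1≤c c<d
  Φe∣xe-1 = divides (∏Φ (properDivisors e)) (ids e 1≤e e<K)
  α = proj₁ (xk-1-gcd-combination c d e bez)
  β = proj₁ (proj₂ (xk-1-gcd-combination c d e bez))
  comb = ≋-trans (proj₂ (proj₂ (xk-1-gcd-combination c d e bez)))
                 (+-cong (*-cong (≋-refl {α}) (≡⇒≋ (cong xk-1 d≡cm))) ≋-refl)

Φ-coprime : ∀ K d e → IdentitiesBelow K → 1 ≤ d → 1 ≤ e → d < K → e < K → d ≢ e → Coprime (Φ d) (Φ e)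
Φ-coprime K d e ids 1≤d 1≤e d<K e<K d≢e with Bézout.lemma d e
... | Bézout.result c gcd bez with ℕP.<-cmp c d
...   | tri< c<d _ _ = Φ-coprime-via-gcd K c d e ids bez c∣d 1≤c c<d d<K 1≤e e<K
  where
  c∣d = proj₁ (GCD.commonDivisor gcd)
  1≤c = ∣-positive c∣d 1≤d
...   | tri≈ _ refl _ = Coprime-sym (Φ-coprime-via-gcd K d e d ids (Bézout.Identity.sym bez) c∣e 1≤d d<e e<K 1≤d d<K)
  where
  c∣e = proj₂ (GCD.commonDivisor gcd)
  d<e : d < e
  d<e with ℕP.m≤n⇒m<n∨m≡n (ℕD.∣⇒≤ ⦃ ℕ.>-nonZero 1≤e ⦄ c∣e)
  ... | inj₁ d<e = d<e
  ... | inj₂ d≡e = ⊥-elim (d≢e d≡e)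
...   | tri> _ _ d<c = ⊥-elim (ℕP.<⇒≱ d<c (ℕD.∣⇒≤ ⦃ ℕ.>-nonZero 1≤d ⦄ (proj₁ (GCD.commonDivisor gcd))))

Coprime-Φ-∏Φ : ∀ K d L → IdentitiesBelow K → 1 ≤ d → d < K → All (d <_) L → All (λ e → 1 ≤ e × e < K) L →
               Coprime (Φ d) (∏Φ L)
Coprime-Φ-∏Φ K d []      ids 1≤d d<K []          []                 = Coprime-1ₚ
Coprime-Φ-∏Φ K d (e ∷ L) ids 1≤d d<K (d<e ∷ d<L) ((1≤e , e<K) ∷ L<K) =
  Coprime-*ʳ (Φ-coprime K d e ids 1≤d 1≤e d<K e<K (ℕP.<⇒≢ d<e)) (Coprime-Φ-∏Φ K d L ids 1≤d d<K d<L L<K)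

∏Φ-∣-xk-1 : ∀ K L → IdentitiesBelow K → AllPairs _<_ L → All (λ d → d ∣ℕ K × 1 ≤ d × d < K) L →
            ∏Φ L ∣ xk-1 K
∏Φ-∣-xk-1 K []      ids []            []                          = divides (xk-1 K) (*-identityˡ (xk-1 K))
∏Φ-∣-xk-1 K (d ∷ L) ids (d<L ∷ L-inc) ((ℕD.divides q K≡qd , 1≤d , d<K) ∷ L-div) =
  Coprime⇒*∣ (Coprime-Φ-∏Φ K d L ids 1≤d d<K d<L (All.map (λ (_ , 1≤e , e<K) → 1≤e , e<K) L-div))
             (∣-trans (divides (∏Φ (properDivisors d)) (ids d 1≤d d<K))
                      (∣-resp (≡⇒≋ (cong xk-1 (trans (ℕP.*-comm d q) (sym K≡qd)))) (xk-1-∣ d q)))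
             (∏Φ-∣-xk-1 K L ids L-inc L-div)

∏Φ-Monic : ∀ L → All (λ d → ∃[ n ] Monic (Φ d) n) L → ∃[ n ] Monic (∏Φ L) n
∏Φ-Monic []      []                  = 0 , ((λ ()) , λ { (suc n) _ → refl }) , refl
∏Φ-Monic (d ∷ L) ((a , Φd-monic) ∷ L-monic) =
  let (b , ∏-monic) = ∏Φ-Monic L L-monic in a ℕ.+ b , Monic-* (Φ d) (∏Φ L) a b Φd-monic ∏-monic

CyclotomicFacts : ℕ → Set
CyclotomicFacts k = (∃[ n ] Monic (Φ k) n) × CyclotomicIdentity k

-- Φ k is computed as the quotient of x^k - 1 by the monic divisor ∏ Φ d over the proper divisors d.
cyclotomic-facts : ∀ k → 1 ≤ k → CyclotomicFacts k
cyclotomic-facts = <-rec (λ k → 1 ≤ k → CyclotomicFacts k) step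
  where
  step : ∀ k → (∀ {j} → j < k → 1 ≤ j → CyclotomicFacts j) → 1 ≤ k → CyclotomicFacts k
  step (suc n) rec _ = Monic-quotient (xk-1 K) P (Φ K) K _ (Monic-xk-1 K (s≤s z≤n)) P-monic xK≋ΦP , identity
    where
    K = suc n
    P = ∏Φ (properDivisors K)
    props = properDivisors-properties K
    P-monic = proj₂ (∏Φ-Monic _ (All.map (λ (_ , 1≤d , d<K) → proj₁ (rec d<K 1≤d)) props))
    xK≋ΦP : xk-1 K ≋ Φ K *ₚ P
    xK≋ΦP = ≋-trans (quotMonic-correct (xk-1 K) P _ P-monic
                       (∏Φ-∣-xk-1 K _ (λ j 1≤j j<K → proj₂ (rec j<K 1≤j)) (properDivisors-increasing K) props))
                    (*-cong (≡⇒≋ (sym (Φ-unfold n))) (≋-refl {P}))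
    identity : CyclotomicIdentity K
    identity = ≋-sym xK≋ΦP

-- Cancelling Φ 1 = x - 1 from Φ k · ∏ Φ d = x^k - 1 leaves Φ k ∣ 1 + x + ... + x^(k-1),
-- which is k at 1.
Φ-1-nonZero : ∀ k → 2 ≤ k → eval (Φ k) 1ℚ ≢ 0ℚ
Φ-1-nonZero k 2≤k Φk[1]≡0 = toℚ-nonZero k 1≤k (begin
  toℚ k                          ≡⟨ eval-geometric-1 k ⟨
  eval (geometric 1 k) 1ℚ         ≡⟨ eval-resp 1ℚ (equation Φk∣G) ⟨
  eval (Φ k *ₚ P) 1ℚ              ≡⟨ eval-* (Φ k) P 1ℚ ⟩
  eval (Φ k) 1ℚ * eval P 1ℚ       ≡⟨ cong (_* eval P 1ℚ) Φk[1]≡0 ⟩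
  0ℚ * eval P 1ℚ                  ≡⟨ ℚP.*-zeroˡ (eval P 1ℚ) ⟩
  0ℚ                              ∎)
  where
  open ≡-Reasoning
  1≤k = ℕP.<⇒≤ 2≤k
  identity : ∀ j → 1 ≤ j → CyclotomicIdentity j
  identity j 1≤j = proj₂ (cyclotomic-facts j 1≤j)
  Φk∣G = Φ-∣-geometric 1 k k (identity 1 ℕP.≤-refl) (identity k 1≤k) (sym (ℕP.*-identityˡ k)) ℕP.≤-refl 2≤k
  P = quotient Φk∣G

-- Square roots of -D modulo r and the embedding of ℚ(√-D)

∘-cong-mod : ∀ r f s s′ → r ∣ s -ₚ s′ → r ∣ (f ∘ₚ s) -ₚ (f ∘ₚ s′)
∘-cong-mod r []      s s′ r∣s-s′ = ∣-zero ≋-refl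
∘-cong-mod r (c ∷ f) s s′ r∣s-s′ =
  ∣-resp (≋-sym (split (const c) s s′ (f ∘ₚ s) (f ∘ₚ s′)))
         (∣-+ (∣-*ˡ s (∘-cong-mod r f s s′ r∣s-s′)) (∣-*ʳ (f ∘ₚ s′) r∣s-s′))
  where
  split : ∀ C s s′ A A′ → (C +ₚ s *ₚ A) -ₚ (C +ₚ s′ *ₚ A′) ≋ s *ₚ (A -ₚ A′) +ₚ (s -ₚ s′) *ₚ A′
  split = solve-∀ ℚ[x]-ring

∘-const : ∀ f a → f ∘ₚ const a ≋ const (eval f a)
∘-const []      a = mk λ { zero → refl ; (suc n) → refl }
∘-const (c ∷ f) a = +-cong (≋-refl {const c}) (≋-trans (*-cong (≋-refl {const a}) (∘-const f a)) (const-* a (eval f a)))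

-- If t ≡ 2 modulo r then Φ k (t - 1) ≡ Φ k (1), a non-zero constant.
∤-reduced-trace : ∀ k r t → 2 ≤ k → NonConstant r → r ∣ Φ k ∘ₚ (t -ₚ 1ₚ) → ¬ (r ∣ t -ₚ (1ₚ +ₚ 1ₚ))
∤-reduced-trace k r t 2≤k r-nc r∣Φk[t-1] r∣t-2 =
  NonConstant-∤const (eval (Φ k) 1ℚ) r-nc (Φ-1-nonZero k 2≤k)
    (∣-resp (≋-trans (cancel (Φ k ∘ₚ (t -ₚ 1ₚ)) (Φ k ∘ₚ 1ₚ)) (∘-const (Φ k) 1ℚ))
            (∣-- r∣Φk[t-1] (∘-cong-mod r (Φ k) (t -ₚ 1ₚ) 1ₚ (∣-resp (two-steps t) r∣t-2))))
  where
  two-steps : ∀ t → t -ₚ (1ₚ +ₚ 1ₚ) ≋ (t -ₚ 1ₚ) -ₚ 1ₚ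
  two-steps = solve-∀ ℚ[x]-ring
  cancel : ∀ a b → a -ₚ (a -ₚ b) ≋ b
  cancel = solve-∀ ℚ[x]-ring

-- 4 h r = 4 (q + 1 - t) = (t - 2)² + (4 q - t²).
∣-norm : ∀ D r t q h y → h *ₚ r ≋ (q +ₚ 1ₚ) -ₚ t → D *ₚ (y *ₚ y) ≋ const (+ 4 / 1) *ₚ q -ₚ t *ₚ t →
         r ∣ (t -ₚ (1ₚ +ₚ 1ₚ)) *ₚ (t -ₚ (1ₚ +ₚ 1ₚ)) +ₚ D *ₚ (y *ₚ y)
∣-norm D r t q h y hr≋ Dy²≋ = ∣-resp (≋-sym (begin
  T *ₚ T +ₚ D *ₚ (y *ₚ y)                         ≈⟨ +-cong (≋-refl {T *ₚ T}) Dy²≋ ⟩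
  T *ₚ T +ₚ (4ₚ *ₚ q -ₚ t *ₚ t)                     ≈⟨ +-cong (≋-refl {T *ₚ T}) (+-cong (*-cong (≋-refl {4ₚ}) q≋) ≋-refl) ⟩
  T *ₚ T +ₚ (4ₚ *ₚ ((h *ₚ r +ₚ t) -ₚ 1ₚ) -ₚ t *ₚ t) ≈⟨ expand t h r ⟩
  (4ₚ *ₚ h) *ₚ r                                  ∎))
  (∣-*ˡ (4ₚ *ₚ h) ∣-refl)
  where
  open ≋-Reasoning
  4ₚ = 1ₚ +ₚ 1ₚ +ₚ 1ₚ +ₚ 1ₚ
  T = t -ₚ (1ₚ +ₚ 1ₚ)
  q≋ : q ≋ (h *ₚ r +ₚ t) -ₚ 1ₚ
  q≋ = ≋-trans (≋-sym (cancel q t)) (+-cong (+-cong (≋-sym hr≋) (≋-refl {t})) ≋-refl)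
    where
    cancel : ∀ q t → (((q +ₚ 1ₚ) -ₚ t) +ₚ t) -ₚ 1ₚ ≋ q
    cancel = solve-∀ ℚ[x]-ring
  expand : ∀ t h r → (t -ₚ (1ₚ +ₚ 1ₚ)) *ₚ (t -ₚ (1ₚ +ₚ 1ₚ)) +ₚ ((1ₚ +ₚ 1ₚ +ₚ 1ₚ +ₚ 1ₚ) *ₚ ((h *ₚ r +ₚ t) -ₚ 1ₚ) -ₚ t *ₚ t)
                   ≋ ((1ₚ +ₚ 1ₚ +ₚ 1ₚ +ₚ 1ₚ) *ₚ h) *ₚ r
  expand = solve-∀ ℚ[x]-ring

-- In the field ℚ[x]/(r): if A² + δ B² = 0 and A ≠ 0 then B ≠ 0, and A/B squares to -δ.
∃-sqrt-mod : ∀ r δ A B → Irreducible r → r ∣ A *ₚ A +ₚ δ *ₚ (B *ₚ B) → ¬ (r ∣ A) →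
             ∃[ e ] (r ∣ negₚ δ -ₚ e *ₚ e)
∃-sqrt-mod r δ A B r-irr r∣norm r∤A = A *ₚ B⁻¹ ,
  ∣-resp (≋-sym (rewrite-norm A B B⁻¹ δ))
         (∣-+ (∣-neg (∣-*ʳ (B⁻¹ *ₚ B⁻¹) r∣norm)) (∣-*ˡ δ (∣-*ʳ (B⁻¹ *ₚ B +ₚ 1ₚ) B⁻¹-inverse)))
  where
  r∤1 : ¬ (r ∣ 1ₚ)
  r∤1 = NonConstant-∤const 1ℚ (proj₁ r-irr) ℚP.1≢0
  A⁻¹ = proj₁ (inverse-mod-irreducible r A r-irr r∤A)
  r∤B : ¬ (r ∣ B)
  r∤B r∣B = r∤1 (∣-resp (unit A A⁻¹) (∣-- (∣-*ʳ (A⁻¹ *ₚ A⁻¹) r∣A²)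
                                        (∣-*ʳ (A⁻¹ *ₚ A +ₚ 1ₚ) (proj₂ (inverse-mod-irreducible r A r-irr r∤A)))))
    where
    r∣A² : r ∣ A *ₚ A
    r∣A² = ∣-resp (cancel (A *ₚ A) (δ *ₚ (B *ₚ B))) (∣-- r∣norm (∣-*ˡ δ (∣-*ʳ B r∣B)))
      where
      cancel : ∀ a b → (a +ₚ b) -ₚ b ≋ a
      cancel = solve-∀ ℚ[x]-ring
    unit : ∀ A w → (A *ₚ A) *ₚ (w *ₚ w) -ₚ (w *ₚ A -ₚ 1ₚ) *ₚ (w *ₚ A +ₚ 1ₚ) ≋ 1ₚ
    unit = solve-∀ ℚ[x]-ring
  B⁻¹ = proj₁ (inverse-mod-irreducible r B r-irr r∤B)
  B⁻¹-inverse = proj₂ (inverse-mod-irreducible r B r-irr r∤B)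
  rewrite-norm : ∀ A B B⁻¹ δ → negₚ δ -ₚ (A *ₚ B⁻¹) *ₚ (A *ₚ B⁻¹) ≋
                 negₚ ((A *ₚ A +ₚ δ *ₚ (B *ₚ B)) *ₚ (B⁻¹ *ₚ B⁻¹)) +ₚ δ *ₚ ((B⁻¹ *ₚ B -ₚ 1ₚ) *ₚ (B⁻¹ *ₚ B +ₚ 1ₚ))
  rewrite-norm = solve-∀ ℚ[x]-ring

square-nonNeg : ∀ c → ℚ.NonNegative (c * c)
square-nonNeg c with ℚP.∣p∣≡p∨∣p∣≡-p c
... | inj₁ ∣c∣≡c  = subst ℚ.NonNegative (trans (ℚP.∣p*q∣≡∣p∣*∣q∣ c c) (cong₂ _*_ ∣c∣≡c ∣c∣≡c)) (ℚP.∣-∣-nonNeg (c * c))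
... | inj₂ ∣c∣≡-c = subst ℚ.NonNegative (trans (ℚP.∣p*q∣≡∣p∣*∣q∣ c c) (trans (cong₂ _*_ ∣c∣≡-c ∣c∣≡-c) (neg*neg c)))
                          (ℚP.∣-∣-nonNeg (c * c))
  where
  neg*neg : ∀ c → (- c) * (- c) ≡ c * c
  neg*neg = solve-∀ ℚ-ring

D+c²≢0 : ∀ D → 1 ≤ D → ∀ c → + D / 1 + c * c ≢ 0ℚ
D+c²≢0 (suc D) _ c D+c²≡0 = ℚP.<-irrefl (sym D+c²≡0) (ℚP.positive⁻¹ _ {{D+c²-pos}})
  where
  D+c²-pos = ℚP.pos+nonNeg⇒pos (+ suc D / 1) {{ℚP.normalize-pos (suc D) 1}} (c * c) {{square-nonNeg c}}

√-D↦ : Poly → QD → Poly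
√-D↦ e (a , b) = const a +ₚ b ·ₚ e

module _ (D : ℕ) (r e : Poly) where

  private
    Dₚ = const (+ D / 1)
    φ = √-D↦ e

    φ≋ : ∀ a b → φ (a , b) ≋ const a +ₚ const b *ₚ e
    φ≋ a b = +-cong (≋-refl {const a}) (·≋const-* b e)

  √-D↦-one : r ∣ φ (QD-one D) -ₚ 1ₚ
  √-D↦-one = ∣-zero (≋-trans (+-cong (φ≋ 1ℚ 0ℚ) ≋-refl)
    (≋-trans (+-cong (+-cong (≋-refl {1ₚ}) (*-cong const-zero (≋-refl {e}))) ≋-refl) (cancel 1ₚ)))
    where
    cancel : ∀ x → (x +ₚ [] *ₚ e) -ₚ x ≋ []
    cancel = solve-∀ ℚ[x]-ring

  √-D↦-+ : ∀ u v → r ∣ φ (QD-add D u v) -ₚ (φ u +ₚ φ v)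
  √-D↦-+ (a , b) (c , d) = ∣-zero (≋-trans (+-cong (φ≋ (a + c) (b + d)) (neg-cong (+-cong (φ≋ a b) (φ≋ c d))))
                                            (additive (const a) (const b) (const c) (const d) e))
    where
    additive : ∀ A B C D E → ((A +ₚ C) +ₚ (B +ₚ D) *ₚ E) -ₚ ((A +ₚ B *ₚ E) +ₚ (C +ₚ D *ₚ E)) ≋ []
    additive = solve-∀ ℚ[x]-ring

  -- The defect of multiplicativity is b d (-D - e²).
  √-D↦-* : r ∣ negₚ Dₚ -ₚ e *ₚ e → ∀ u v → r ∣ φ (QD-mul D u v) -ₚ φ u *ₚ φ v
  √-D↦-* e²≡-D (a , b) (c , d) = ∣-resp (≋-sym defect) (∣-*ˡ (const b *ₚ const d) e²≡-D)
    where
    real : const (a * c - (+ D / 1) * (b * d)) ≋ const a *ₚ const c -ₚ Dₚ *ₚ (const b *ₚ const d)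
    real = ≋-sym (+-cong (const-* a c)
                         (neg-cong (≋-trans (*-cong (≋-refl {Dₚ}) (const-* b d)) (const-* (+ D / 1) (b * d)))))
    imaginary : const (a * d + b * c) ≋ const a *ₚ const d +ₚ const b *ₚ const c
    imaginary = ≋-sym (+-cong (const-* a d) (const-* b c))
    multiplicative : ∀ A B C D Dₚ E → ((A *ₚ C -ₚ Dₚ *ₚ (B *ₚ D)) +ₚ (A *ₚ D +ₚ B *ₚ C) *ₚ E) -ₚ (A +ₚ B *ₚ E) *ₚ (C +ₚ D *ₚ E)
                                     ≋ (B *ₚ D) *ₚ (negₚ Dₚ -ₚ E *ₚ E)
    multiplicative = solve-∀ ℚ[x]-ring
    defect : φ (QD-mul D (a , b) (c , d)) -ₚ φ (a , b) *ₚ φ (c , d) ≋ (const b *ₚ const d) *ₚ (negₚ Dₚ -ₚ e *ₚ e)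
    defect = ≋-trans (+-cong (≋-trans (φ≋ (a * c - (+ D / 1) * (b * d)) (a * d + b * c))
                                      (+-cong real (*-cong imaginary (≋-refl {e}))))
                             (neg-cong (*-cong (φ≋ a b) (φ≋ c d))))
                     (multiplicative (const a) (const b) (const c) (const d) Dₚ e)

  -- If b ≠ b′ then e ≡ c for a rational c, and then -D - c² ≡ -D - e² ≡ 0, impossible for D ≥ 1.
  √-D↦-injective : r ∣ negₚ Dₚ -ₚ e *ₚ e → 1 ≤ D → NonConstant r → ∀ u v → r ∣ φ u -ₚ φ v → u ≡ v
  √-D↦-injective e²≡-D 1≤D r-nc (a , b) (a′ , b′) r∣φu-φv with b ℚP.≟ b′
  ... | yes refl with a ℚP.≟ a′
  ...   | yes refl = refl
  ...   | no  a≢a′ = ⊥-elim (NonConstant-∤const (a - a′) r-nc (a≢a′ ∘ x∙y⁻¹≈ε⇒x≈y _ _) (∣-resp same-b r∣φu-φv))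
    where
    same-b : φ (a , b) -ₚ φ (a′ , b) ≋ const (a - a′)
    same-b = ≋-trans (+-cong (φ≋ a b) (neg-cong (φ≋ a′ b))) (cancel (const a) (const a′) (const b) e)
      where
      cancel : ∀ A A′ B E → (A +ₚ B *ₚ E) -ₚ (A′ +ₚ B *ₚ E) ≋ A -ₚ A′
      cancel = solve-∀ ℚ[x]-ring
  √-D↦-injective e²≡-D 1≤D r-nc (a , b) (a′ , b′) r∣φu-φv | no b≢b′ =
    ⊥-elim (NonConstant-∤const (- (+ D / 1 + c * c)) r-nc (D+c²≢0 D 1≤D c ∘ ℚP.neg-injective)
             (∣-resp -D-c² (∣-+ e²≡-D (∣-*ˡ (e +ₚ const c) e≡c))))
    where
    α = a - a′
    β = b - b′
    instance _ = ℚ.≢-nonZero (b≢b′ ∘ x∙y⁻¹≈ε⇒x≈y _ _)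
    c = - (α * ℚ.1/ β)
    r∣α+βe : r ∣ const α +ₚ const β *ₚ e
    r∣α+βe = ∣-resp (≋-trans (+-cong (φ≋ a b) (neg-cong (φ≋ a′ b′)))
                             (regroup (const a) (const a′) (const b) (const b′) e)) r∣φu-φv
      where
      regroup : ∀ A A′ B B′ E → (A +ₚ B *ₚ E) -ₚ (A′ +ₚ B′ *ₚ E) ≋ (A -ₚ A′) +ₚ (B -ₚ B′) *ₚ E
      regroup = solve-∀ ℚ[x]-ring
    e≡c : r ∣ e -ₚ const c
    e≡c = ∣-resp scale (∣-*ˡ (const (ℚ.1/ β)) r∣α+βe)
      where
      β⁻¹β : const (ℚ.1/ β) *ₚ const β ≋ 1ₚ
      β⁻¹β = ≋-trans (const-* (ℚ.1/ β) β) (const-cong (ℚP.*-inverseˡ β))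
      β⁻¹α : const (ℚ.1/ β) *ₚ const α ≋ negₚ (const c)
      β⁻¹α = ≋-trans (const-* (ℚ.1/ β) α)
                     (const-cong (trans (ℚP.*-comm (ℚ.1/ β) α) (sym (⁻¹-involutive (α * ℚ.1/ β)))))
      distribute : ∀ I A B E → I *ₚ (A +ₚ B *ₚ E) ≋ (I *ₚ B) *ₚ E +ₚ I *ₚ A
      distribute = solve-∀ ℚ[x]-ring
      scale : const (ℚ.1/ β) *ₚ (const α +ₚ const β *ₚ e) ≋ e -ₚ const c
      scale = ≋-trans (distribute (const (ℚ.1/ β)) (const α) (const β) e)
                      (+-cong (≋-trans (*-cong β⁻¹β (≋-refl {e})) (*-identityˡ e)) β⁻¹α)
    -D-c² : (negₚ Dₚ -ₚ e *ₚ e) +ₚ (e +ₚ const c) *ₚ (e -ₚ const c) ≋ const (- (+ D / 1 + c * c))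
    -D-c² = ≋-trans (difference-of-squares Dₚ e (const c)) (neg-cong (+-cong (≋-refl {Dₚ}) (const-* c c)))
      where
      difference-of-squares : ∀ Dₚ E C → (negₚ Dₚ -ₚ E *ₚ E) +ₚ (E +ₚ C) *ₚ (E -ₚ C) ≋ negₚ (Dₚ +ₚ C *ₚ C)
      difference-of-squares = solve-∀ ℚ[x]-ring

lemma3p2 : (k D : ℕ) → 2 ≤ k → 1 ≤ D → SquareFree D →
    (t r q : Poly) → CompleteFamily k D t r q →
    (∃[ φ ] FieldEmbedding D r φ) ×
    (∃[ e ] (const (- (+ D / 1)) ≡ e *ₚ e [mod r ]))
lemma3p2 k D 2≤k 1≤D _ t r q (_ , _ , _ , (_ , r-irr , _) , _ , (h , hr≋) , r∣Φk[t-1] , (y , Dy²≋)) =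
  (√-D↦ e , ∣⇒∣ₚ (√-D↦-one D r e) , (λ u v → ∣⇒∣ₚ (√-D↦-+ D r e u v)) ,
            (λ u v → ∣⇒∣ₚ (√-D↦-* D r e e²≡-D u v)) ,
            (λ u v → √-D↦-injective D r e e²≡-D 1≤D (proj₁ r-irr) u v ∘ ∣ₚ⇒∣)) ,
  (e , ∣⇒∣ₚ e²≡-D)
  where
  r∣norm = ∣-norm (const (+ D / 1)) r t q h y (mk hr≋) (mk Dy²≋)
  r∤t-2 = ∤-reduced-trace k r t 2≤k (proj₁ r-irr) (∣ₚ⇒∣ r∣Φk[t-1])
  root = ∃-sqrt-mod r (const (+ D / 1)) _ y r-irr r∣norm r∤t-2
  e = proj₁ root
  e²≡-D = proj₂ root
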